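{- For every $n\geqslant0$, $$\sum_{\pi\in\mathfrak{S}_{n+1}}x^{{\rm basc}(\pi)}y^{{\rm des}(\pi)-{\rm plrmin}(\pi)}s^{{\rm suc}(\pi)}(-s)^{{\rm plrmin}(\pi)}=\sum_{j=0}^{\lfloor n/2\rfloor}\gamma_{n,0,j}(2xy)^j(x+y)^{n-2j}.$$
   Context: For $\pi\in\mathfrak{S}_n$: ${\rm des}(\pi)=\#\{i\in[n-1]:\pi(i)>\pi(i+1)\}$, ${\rm suc}(\pi)=\#\{i\in[n-1]:\pi(i+1)=\pi(i)+1\}$, ${\rm basc}(\pi)=\#\{i\in[n-1]:\pi(i+1)\geqslant\pi(i)+2\}$. Set $\pi(n+1)=0$. A value $\pi(i)$ ($i\in[n]$) is a left-to-right minimum if $i=1$ or $\pi(i)<\pi(j)$ for all $j<i$; it is a proper left-to-right minimum if moreover $\pi(i)\neq1$ and there is $k>i$ with $\pi(k)=\pi(i)-1$ and $\pi(k)>\pi(k+1)$; ${\rm plrmin}(\pi)$ counts these. The integers $\gamma_{n,i,j}$ are defined by $\gamma_{0,0,0}=1$, $\gamma_{0,i,j}=0$ for $(i,j)\neq(0,0)$, $\gamma_{n,i,j}=0$ if an index is negative, and $\gamma_{n+1,i,j}=\gamma_{n,i-1,j}+(1+i)\gamma_{n,i+1,j-1}+j\gamma_{n,i,j}+(n-i-2j+2)\gamma_{n,i,j-1}$. -}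

module Defs where

open import Level using (Level)
open import Data.Bool using (Bool; true; false; if_then_else_; _∧_; not)
open import Data.Nat as ℕ using (ℕ; zero; suc; _∸_; _≡ᵇ_; _<ᵇ_; ⌊_/2⌋)
open import Data.Integer as ℤ using (ℤ; +_; -[1+_])
open import Data.Product using (_×_; _,_)
open import Data.List using (List; []; _∷_; _++_; map; filter; concatMap; upTo; foldr)
open import Data.Bool.ListAction using (all; any)
open import Data.Bool.Properties using (T?)
import Algebra.Bundles
open import Algebra.Bundles using (CommutativeRing)

-- Permutations of [m] = {1,…,m} in one-line notation π(1)…π(m),
-- represented as lists of naturals.

words : ℕ → ℕ → List (List ℕ)
words m zero    = [] ∷ []
words m (suc k) = concatMap (λ a → map (a ∷_) (words m k)) (map suc (upTo m))

occurs : ℕ → List ℕ → Bool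
occurs v w = any (λ a → a ≡ᵇ v) w

-- a word of length m over {1,…,m} is a permutation iff every value 1..m occurs
isPerm : ℕ → List ℕ → Bool
isPerm m w = all (λ v → occurs (suc v) w) (upTo m)

𝔖 : ℕ → List (List ℕ)
𝔖 m = filter (λ w → T? (isPerm m w)) (words m m)

count : {A : Set} → (A → Bool) → List A → ℕ
count p []       = 0
count p (a ∷ as) = (if p a then 1 else 0) ℕ.+ count p as

pairs : List ℕ → List (ℕ × ℕ)
pairs []           = []
pairs (a ∷ [])     = []
pairs (a ∷ b ∷ w)  = (a , b) ∷ pairs (b ∷ w)

isDescent : ℕ × ℕ → Bool
isDescent (a , b) = b <ᵇ a

des : List ℕ → ℕ
des π = count isDescent (pairs π)

sucs : List ℕ → ℕ
sucs π = count (λ { (a , b) → b ≡ᵇ suc a }) (pairs π)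

basc : List ℕ → ℕ
basc π = count (λ { (a , b) → suc a <ᵇ b }) (pairs π)

-- plrmin(π), with the convention π(n+1) = 0.
-- plrminGo pre (π(i) ∷ π(i+1) … π(n)) where pre = π(1) … π(i-1):
--   π(i) is a left-to-right minimum iff it is smaller than every earlier value;
--   it is proper iff π(i) ≠ 1 and some k with i < k ≤ n has π(k) = π(i) - 1
--   and π(k) > π(k+1); the pairs (π(k), π(k+1)) for i < k ≤ n are exactly
--   pairs (π(i+1) … π(n) 0).
plrminGo : List ℕ → List ℕ → ℕ
plrminGo pre []         = 0
plrminGo pre (v ∷ rest) =
  (if all (λ u → v <ᵇ u) pre
      ∧ not (v ≡ᵇ 1)
      ∧ any (λ { (a , b) → (a ≡ᵇ (v ∸ 1)) ∧ (b <ᵇ a) }) (pairs (rest ++ (0 ∷ [])))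
   then 1 else 0)
  ℕ.+ plrminGo (pre ++ (v ∷ [])) rest

plrmin : List ℕ → ℕ
plrmin π = plrminGo [] π

-- The integers γ_{n,i,j}.  Terms with a negative index are 0.
-- γ_{n+1,i,j} = γ_{n,i-1,j} + (1+i) γ_{n,i+1,j-1} + j γ_{n,i,j}
--              + (n-i-2j+2) γ_{n,i,j-1}

γ : ℕ → ℕ → ℕ → ℤ
γ zero zero    zero    = + 1
γ zero zero    (suc j) = + 0
γ zero (suc i) j       = + 0
γ (suc n) i j =
  γprev i j ℤ.+ second i j ℤ.+ (+ j) ℤ.* γ n i j ℤ.+ fourth j
  where
  γprev : ℕ → ℕ → ℤ
  γprev zero    j = + 0
  γprev (suc i) j = γ n i j
  second : ℕ → ℕ → ℤ
  second i zero    = + 0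
  second i (suc j) = (+ suc i) ℤ.* γ n (suc i) j
  fourth : ℕ → ℤ
  fourth zero    = + 0
  fourth (suc j) = ((+ n) ℤ.- (+ i) ℤ.- (+ 2) ℤ.* (+ suc j) ℤ.+ (+ 2)) ℤ.* γ n i j

-- Evaluation in an arbitrary commutative ring R (a polynomial identity with
-- integer coefficients in x, y, s holds in ℤ[x,y,s] iff it holds for all
-- elements of all commutative rings).

module InRing {c ℓ : Level} (R : CommutativeRing c ℓ) where
  open CommutativeRing R
  open import Algebra.Definitions.RawSemiring (Algebra.Bundles.Semiring.rawSemiring semiring) public using (_^_) renaming (_×_ to _·_)

  fromℤ : ℤ → Carrier
  fromℤ (+ k)      = k · 1#
  fromℤ -[1+ k ]   = - (suc k · 1#)

  sumList : {A : Set} → (A → Carrier) → List A → Carrier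
  sumList f []       = 0#
  sumList f (a ∷ as) = f a + sumList f as

  sumTo : ℕ → (ℕ → Carrier) → Carrier
  sumTo m f = sumList f (upTo (suc m))

  LHS : ℕ → Carrier → Carrier → Carrier → Carrier
  LHS n x y s =
    sumList (λ π → (x ^ basc π) * (y ^ (des π ∸ plrmin π)) * (s ^ sucs π)
                     * ((- s) ^ plrmin π))
            (𝔖 (suc n))

  RHS : ℕ → Carrier → Carrier → Carrier
  RHS n x y =
    sumTo ⌊ n /2⌋ (λ j → fromℤ (γ n 0 j) * ((2 · 1#) * x * y) ^ j
                           * (x + y) ^ (n ∸ 2 ℕ.* j))

{-# OPTIONS --safe #-}

-- Write L n for the left-hand side with t in place of -s. Inserting the new maximum into a
-- permutation π of [n + 1] right after π(i) changes the statistics in a way determined by the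
-- pair (π(i), π(i+1)) (with π(n+2) = 0), and at the front it multiplies the weight by t; summing
-- over all positions and all π gives
--   L (n + 1) = (s + t) L n + δ (L n),   δ = x y (∂x + ∂y + ∂s + ∂t).
-- On the other side, Γ n = Σ γ(n,i,j) u^i v^j z^(n-i-2j) satisfies Γ (n + 1) = u Γ n + δ (Γ n),
-- since at u = s + t, v = 2 x y, z = x + y one has δu = v, δv = v z, δz = v, and the recursion of
-- γ is exactly the coefficient comparison. So L n = Γ n by induction on n, where δ (L n) = δ (Γ n)
-- is obtained by applying the induction hypothesis over the dual numbers R[ε], at
-- x + x y ε, y + x y ε, s + x y ε, t + x y ε. Putting t = -s makes u = 0, leaving the terms i = 0.

module Submission where

open import Defs
open import Level using (Level)
open import Data.Nat using (ℕ)
open import Algebra.Bundles using (CommutativeRing)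

module Permutations where

  open import Data.Nat as ℕ using (ℕ; zero; suc; _≤_; s≤s; z≤n)
  import Data.Nat.Properties as ℕ
  open import Data.Bool using (T)
  open import Data.Bool.Properties using (T?)
  open import Data.List using (List; []; _∷_; _++_; [_]; map; length; concatMap; upTo; filter)
  import Data.List.Properties as List
  open import Data.List.Membership.Propositional using (_∈_; _∉_; find; lose)
  open import Data.List.Membership.Propositional.Properties
    using ( ∈-++⁻; ∈-++⁺ˡ; ∈-++⁺ʳ; ∈-∃++; ∈-map⁻; ∈-map⁺; ∈-upTo⁻; ∈-upTo⁺

          ; ∈-concatMap⁺; ∈-concatMap⁻; ∈-filter⁻; ∈-filter⁺ )
  open import Data.List.Membership.Propositional.Properties.WithK using (unique∧set⇒bag)
  open import Data.List.Relation.Binary.BagAndSetEquality using (∼bag⇒↭)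
  open import Data.List.Relation.Binary.Subset.Propositional using (_⊆_)
  open import Data.List.Relation.Binary.Permutation.Propositional using (_↭_; ↭-refl; ↭-sym; ↭-trans; prep; ↭⇒↭ₛ)
  import Data.List.Relation.Binary.Permutation.Setoid.Properties as ↭ₛ
  open import Data.List.Relation.Binary.Permutation.Propositional.Properties
    using (shift; ↭-length; ∷↭∷ʳ; ∈-resp-↭; drop-∷)
  open import Data.List.Relation.Unary.Any using (here; there)
  import Data.List.Relation.Unary.Any as Any
  open import Data.List.Relation.Unary.Any.Properties using (any⁺; any⁻)
  open import Data.List.Relation.Unary.All using (All; []; _∷_)
  import Data.List.Relation.Unary.All as All
  open import Data.List.Relation.Unary.All.Properties using (all⁺; all⁻)
  import Data.List.Relation.Unary.All.Properties as All
  open import Data.List.Relation.Unary.AllPairs as AllPairs using (AllPairs; []; _∷_)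
  import Data.List.Relation.Unary.AllPairs.Properties as AllPairs
  open import Data.List.Relation.Unary.Unique.Propositional using (Unique)
  import Data.List.Relation.Unary.Unique.Propositional.Properties as Unique
  open import Data.Product using (_×_; _,_; ∃₂; proj₂)
  open import Data.Sum using (inj₁; inj₂)
  open import Data.Empty using (⊥-elim)
  open import Relation.Nullary using (¬?)
  open import Function using (_∘_; _⇔_; mk⇔)
  open import Function.Bundles using (Equivalence)
  open import Relation.Binary.PropositionalEquality using (_≡_; _≢_; refl; sym; trans; cong; subst; setoid; module ≡-Reasoning)

  module _ {A : Set} where

    ∈-++-∷⁻ : ∀ {x z : A} as {bs} → z ∈ as ++ x ∷ bs → z ≢ x → z ∈ as ++ bs
    ∈-++-∷⁻ as z∈ z≢x with ∈-++⁻ as z∈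
    ... | inj₁ z∈as         = ∈-++⁺ˡ z∈as
    ... | inj₂ (here z≡x)   = ⊥-elim (z≢x z≡x)
    ... | inj₂ (there z∈bs) = ∈-++⁺ʳ as z∈bs

    AllPairs-mapWithAll : ∀ {P : A → Set} {R S : A → A → Set} {xs} →
                          (∀ {x y} → P x → P y → R x y → S x y) → All P xs → AllPairs R xs → AllPairs S xs
    AllPairs-mapWithAll f []         []         = []
    AllPairs-mapWithAll f (px ∷ pxs) (rx ∷ rxs) =
      All.zipWith (λ (py , r) → f px py r) (pxs , rx) ∷ AllPairs-mapWithAll f pxs rxs

    Unique-map⇒injectiveOn : ∀ {B : Set} (f : A → B) {xs x y} → Unique (map f xs) →
                             x ∈ xs → y ∈ xs → f x ≡ f y → x ≡ y
    Unique-map⇒injectiveOn f {_ ∷ _} _             (here refl) (here refl) _   = refl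
    Unique-map⇒injectiveOn f {_ ∷ _} (fx∉ ∷ _) (here refl) (there y∈)  fx≡ =
      ⊥-elim (All.lookup fx∉ (∈-map⁺ f y∈) fx≡)
    Unique-map⇒injectiveOn f {_ ∷ _} (fy∉ ∷ _) (there x∈)  (here refl) fx≡ =
      ⊥-elim (All.lookup fy∉ (∈-map⁺ f x∈) (sym fx≡))
    Unique-map⇒injectiveOn f {_ ∷ _} (_ ∷ uniq) (there x∈)  (there y∈)  fx≡ =
      Unique-map⇒injectiveOn f uniq x∈ y∈ fx≡

    pigeonhole-↭ : ∀ {xs ys : List A} → Unique xs → xs ⊆ ys → length ys ≤ length xs → ys ↭ xs
    pigeonhole-↭ {[]}     {[]}    _ _ _ = ↭-refl
    pigeonhole-↭ {x ∷ xs} (x∉xs ∷ uxs) xs⊆ys len≤ with ∈-∃++ (xs⊆ys (here refl))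
    ... | as , bs , refl =
      ↭-trans (shift x as bs)
            (prep x (pigeonhole-↭ uxs
                       (λ z∈xs → ∈-++-∷⁻ as (xs⊆ys (there z∈xs)) (All.lookup x∉xs z∈xs ∘ sym))
                       (ℕ.≤-pred (subst (_≤ length (x ∷ xs)) (↭-length (shift x as bs)) len≤))))

  oneTo : ℕ → List ℕ
  oneTo m = map suc (upTo m)

  ∈-oneTo⁻ : ∀ {m v} → v ∈ oneTo m → 1 ≤ v × v ≤ m
  ∈-oneTo⁻ v∈ with ∈-map⁻ suc v∈
  ... | i , i∈ , refl = s≤s z≤n , ∈-upTo⁻ i∈

  ∈-oneTo⁺ : ∀ {m v} → 1 ≤ v → v ≤ m → v ∈ oneTo m
  ∈-oneTo⁺ {v = suc i} _ i<m = ∈-map⁺ suc (∈-upTo⁺ i<m)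

  oneTo-unique : ∀ m → Unique (oneTo m)
  oneTo-unique m = Unique.map⁺ ℕ.suc-injective (Unique.upTo⁺ m)

  length-oneTo : ∀ m → length (oneTo m) ≡ m
  length-oneTo m = trans (List.length-map suc (upTo m)) (List.length-upTo m)

  oneTo-suc-↭ : ∀ m → oneTo (suc m) ↭ suc m ∷ oneTo m
  oneTo-suc-↭ m = subst (_↭ suc m ∷ oneTo m)
    (trans (sym (List.map-++ suc (upTo m) [ m ])) (cong (map suc) (List.upTo-∷ʳ m)))
    (↭-sym (∷↭∷ʳ (suc m) (oneTo m)))

  oneTo-suc : ∀ m → oneTo (suc m) ≡ 1 ∷ map suc (oneTo m)
  oneTo-suc m = cong (1 ∷_) (cong (map suc) (sym (List.map-upTo suc m)))

  ∈-words⁺ : ∀ m k w → length w ≡ k → All (_∈ oneTo m) w → w ∈ words m k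
  ∈-words⁺ m zero    []      refl []          = here refl
  ∈-words⁺ m (suc k) (a ∷ w) refl (a∈ ∷ w⊆) =
    ∈-concatMap⁺ (λ b → map (b ∷_) (words m k))
                 (Any.map (λ { refl → ∈-map⁺ (a ∷_) (∈-words⁺ m k w refl w⊆) }) a∈)

  ∈-words⁻ : ∀ m k w → w ∈ words m k → length w ≡ k × All (_∈ oneTo m) w
  ∈-words⁻ m zero    [] (here refl) = refl , []
  ∈-words⁻ m (suc k) w  w∈ with find (∈-concatMap⁻ (λ a → map (a ∷_) (words m k)) {xs = oneTo m} w∈)
  ... | a , a∈ , w∈' with ∈-map⁻ (a ∷_) w∈'
  ... | w' , w'∈ , refl with ∈-words⁻ m k w' w'∈
  ... | refl , w'⊆ = refl , a∈ ∷ w'⊆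

  words-unique : ∀ m k → Unique (words m k)
  words-unique m zero    = [] ∷ []
  words-unique m (suc k) =
    Unique.concat⁺ (All.map⁺ (All.tabulate (λ _ → Unique.map⁺ List.∷-injectiveʳ (words-unique m k))))
                   (AllPairs.map⁺ (AllPairs.map (λ a≢b {_} w∈ → a≢b (heads w∈)) (oneTo-unique m)))
    where
    heads : ∀ {a b} {v : List ℕ} → v ∈ map (a ∷_) (words m k) × v ∈ map (b ∷_) (words m k) → a ≡ b
    heads (p , q) with ∈-map⁻ _ p | ∈-map⁻ _ q
    ... | _ , _ , refl | _ , _ , refl = refl

  T-occurs⇔∈ : ∀ v w → T (occurs v w) ⇔ v ∈ w
  T-occurs⇔∈ v w = mk⇔ (Any.map (λ t → sym (ℕ.≡ᵇ⇒≡ _ v t)) ∘ any⁻ _ w)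
                       (any⁺ _ ∘ Any.map (λ { refl → ℕ.≡⇒≡ᵇ v v refl }))

  ∈-𝔖⁻ : ∀ {m w} → w ∈ 𝔖 m → w ↭ oneTo m
  ∈-𝔖⁻ {m} {w} w∈ with ∈-filter⁻ (T? ∘ isPerm m) {xs = words m m} w∈
  ... | w∈words , isPerm-w with ∈-words⁻ m m w w∈words
  ... | length≡ , _ =
    pigeonhole-↭ (oneTo-unique m) oneTo⊆w (ℕ.≤-reflexive (trans length≡ (sym (length-oneTo m))))
    where
    oneTo⊆w : oneTo m ⊆ w
    oneTo⊆w v∈ with ∈-map⁻ suc v∈
    ... | i , i∈ , refl = Equivalence.to (T-occurs⇔∈ (suc i) w) (All.lookup (all⁺ _ (upTo m) isPerm-w) i∈)

  ∈-𝔖⁺ : ∀ {m w} → w ↭ oneTo m → w ∈ 𝔖 m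
  ∈-𝔖⁺ {m} {w} w↭ =
    ∈-filter⁺ (T? ∘ isPerm m)
      (∈-words⁺ m m w (trans (↭-length w↭) (length-oneTo m)) (All.tabulate (∈-resp-↭ w↭)))
      (all⁻ _ (All.tabulate (λ {i} i∈ →
        Equivalence.from (T-occurs⇔∈ (suc i) w) (∈-resp-↭ (↭-sym w↭) (∈-map⁺ suc i∈)))))

  𝔖-unique : ∀ m → Unique (𝔖 m)
  𝔖-unique m = Unique.filter⁺ (T? ∘ isPerm m) (words-unique m m)

  ∈-𝔖-range : ∀ {m π v} → π ∈ 𝔖 m → v ∈ π → 1 ≤ v × v ≤ m
  ∈-𝔖-range π∈ v∈ = ∈-oneTo⁻ (∈-resp-↭ (∈-𝔖⁻ π∈) v∈)

  ∈-𝔖-unique : ∀ {m π} → π ∈ 𝔖 m → Unique π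
  ∈-𝔖-unique {m} π∈ = ↭ₛ.Unique-resp-↭ (setoid ℕ) (↭⇒↭ₛ (↭-sym (∈-𝔖⁻ {m} π∈))) (oneTo-unique m)

  suc∉𝔖 : ∀ {m π} → π ∈ 𝔖 m → suc m ∉ π
  suc∉𝔖 π∈ m+1∈ = ℕ.<-irrefl refl (proj₂ (∈-𝔖-range π∈ m+1∈))

  insertions : ℕ → List ℕ → List (List ℕ)
  insertions X []      = [ [ X ] ]
  insertions X (a ∷ π) = (X ∷ a ∷ π) ∷ map (a ∷_) (insertions X π)

  ∈-insertions⁺ : ∀ X as bs → as ++ X ∷ bs ∈ insertions X (as ++ bs)
  ∈-insertions⁺ X []       []       = here refl
  ∈-insertions⁺ X []       (b ∷ bs) = here refl
  ∈-insertions⁺ X (a ∷ as) bs       = there (∈-map⁺ (a ∷_) (∈-insertions⁺ X as bs))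

  ∈-insertions⁻ : ∀ X π {w} → w ∈ insertions X π → ∃₂ λ as bs → π ≡ as ++ bs × w ≡ as ++ X ∷ bs
  ∈-insertions⁻ X []      (here refl) = [] , [] , refl , refl
  ∈-insertions⁻ X (a ∷ π) (here refl) = [] , a ∷ π , refl , refl
  ∈-insertions⁻ X (a ∷ π) (there w∈) with ∈-map⁻ (a ∷_) w∈
  ... | w' , w'∈ , refl with ∈-insertions⁻ X π w'∈
  ... | as , bs , refl , refl = a ∷ as , bs , refl , refl

  erase : ℕ → List ℕ → List ℕ
  erase X = filter (λ v → ¬? (v ℕ.≟ X))

  erase-insertion : ∀ X as bs → X ∉ as ++ bs → erase X (as ++ X ∷ bs) ≡ as ++ bs
  erase-insertion X as bs X∉ = begin
    erase X (as ++ X ∷ bs)        ≡⟨ List.filter-++ P? as (X ∷ bs) ⟩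
    erase X as ++ erase X (X ∷ bs) ≡⟨ cong (erase X as ++_) (List.filter-reject P? (λ X≢X → X≢X refl)) ⟩
    erase X as ++ erase X bs       ≡⟨ sym (List.filter-++ P? as bs) ⟩
    erase X (as ++ bs)             ≡⟨ List.filter-all P? (All.tabulate (λ v∈ v≡X → X∉ (subst (_∈ _) v≡X v∈))) ⟩
    as ++ bs                       ∎
    where
    open ≡-Reasoning
    P? = λ v → ¬? (v ℕ.≟ X)

  insertions-disjoint : ∀ {X π π' w} → X ∉ π → X ∉ π' →
                        w ∈ insertions X π → w ∈ insertions X π' → π ≡ π'
  insertions-disjoint {X} {π} {π'} X∉π X∉π' w∈ w∈'
    with ∈-insertions⁻ X π w∈ | ∈-insertions⁻ X π' w∈'
  ... | as , bs , refl , refl | as' , bs' , refl , w≡ =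
    trans (sym (erase-insertion X as bs X∉π)) (trans (cong (erase X) w≡) (erase-insertion X as' bs' X∉π'))

  insertions-↭ : ∀ X π {w} → w ∈ insertions X π → w ↭ X ∷ π
  insertions-↭ X π w∈ with ∈-insertions⁻ X π w∈
  ... | as , bs , refl , refl = shift X as bs

  insertions-unique : ∀ {X} π → X ∉ π → Unique (insertions X π)
  insertions-unique []      _   = [] ∷ []
  insertions-unique {X} (a ∷ π) X∉ =
    All.tabulate head∉ ∷ Unique.map⁺ List.∷-injectiveʳ (insertions-unique π (X∉ ∘ there))
    where
    head∉ : ∀ {v} → v ∈ map (a ∷_) (insertions X π) → X ∷ a ∷ π ≢ v
    head∉ v∈ X∷a∷π≡v with ∈-map⁻ (a ∷_) v∈
    head∉ v∈ refl | _ , _ , refl = X∉ (here refl)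

  𝔖-suc-↭ : ∀ m → 𝔖 (suc m) ↭ concatMap (insertions (suc m)) (𝔖 m)
  𝔖-suc-↭ m = ∼bag⇒↭ (unique∧set⇒bag (𝔖-unique (suc m)) unique (mk⇔ to from))
    where
    X = suc m
    unique : Unique (concatMap (insertions X) (𝔖 m))
    unique = Unique.concat⁺
      (All.map⁺ (All.tabulate (λ π∈ → insertions-unique _ (suc∉𝔖 π∈))))
      (AllPairs.map⁺ (AllPairs-mapWithAll
        (λ π∈ π'∈ π≢π' (w∈ , w∈') → π≢π' (insertions-disjoint (suc∉𝔖 π∈) (suc∉𝔖 π'∈) w∈ w∈'))
        (All.tabulate (λ π∈ → π∈)) (𝔖-unique m)))
    to : ∀ {w} → w ∈ 𝔖 (suc m) → w ∈ concatMap (insertions X) (𝔖 m)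
    to {w} w∈ with ∈-∃++ (∈-resp-↭ (↭-sym (∈-𝔖⁻ w∈)) (∈-oneTo⁺ {suc m} (s≤s z≤n) ℕ.≤-refl))
    ... | as , bs , refl = ∈-concatMap⁺ (insertions X) (lose π∈ (∈-insertions⁺ X as bs))
      where
      π∈ : as ++ bs ∈ 𝔖 m
      π∈ = ∈-𝔖⁺ (drop-∷ (↭-trans (↭-sym (shift X as bs)) (↭-trans (∈-𝔖⁻ w∈) (oneTo-suc-↭ m))))
    from : ∀ {w} → w ∈ concatMap (insertions X) (𝔖 m) → w ∈ 𝔖 (suc m)
    from w∈ with find (∈-concatMap⁻ (insertions X) {xs = 𝔖 m} w∈)
    ... | π , π∈ , w∈' =
      ∈-𝔖⁺ (↭-trans (insertions-↭ X π w∈') (↭-trans (prep X (∈-𝔖⁻ π∈)) (↭-sym (oneTo-suc-↭ m))))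

module Statistics where

  open Permutations
  open import Data.Nat as ℕ using (ℕ; zero; suc; _+_; _∸_; _≤_; _<_; s≤s; z≤n; _≡ᵇ_; _<ᵇ_)
  import Data.Nat.Properties as ℕ
  open import Data.Nat.Solver using (module +-*-Solver)
  open import Data.Bool using (Bool; true; false; T; _∧_; _∨_; not; if_then_else_)
  import Data.Bool.Properties as Bool
  open import Data.Bool.ListAction using (all; any)
  open import Data.List using (List; []; _∷_; _++_; [_]; map)
  import Data.List.Properties as List
  open import Data.List.Membership.Propositional using (_∈_; _∉_; find; lose)
  open import Data.List.Membership.Propositional.Properties using (∈-++⁺ʳ; ∈-++⁺ˡ; ∈-++⁻; ∈-map⁺; ∈-map⁻)
  open import Data.List.Relation.Binary.Permutation.Propositional using (_↭_; ↭-sym; prep; swap)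
  import Data.List.Relation.Binary.Permutation.Propositional as ↭
  open import Data.List.Relation.Binary.Permutation.Propositional.Properties using (∈-resp-↭; map⁺)
  open import Data.List.Relation.Unary.Any using (here; there)
  open import Data.List.Relation.Unary.All using (All; []; _∷_)
  import Data.List.Relation.Unary.All as All
  open import Data.List.Relation.Unary.AllPairs using ([]; _∷_)
  open import Data.List.Relation.Unary.Unique.Propositional using (Unique)
  import Data.List.Relation.Unary.Unique.Propositional.Properties as Unique
  open import Data.Product using (Σ; _×_; _,_; proj₁; proj₂)
  open import Data.Sum using (inj₁; inj₂)
  open import Data.Empty using (⊥-elim)
  open import Function using (_∘_)
  open import Function.Bundles using (Equivalence)
  open import Relation.Binary.PropositionalEquality using (_≡_; _≢_; refl; sym; trans; cong; cong₂; subst; module ≡-Reasoning)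
  open import Relation.Nullary using (¬_; yes; no)
  open import Relation.Binary.Definitions using (tri<; tri≈; tri>)
  open import Data.List.Relation.Unary.Any.Properties using (any⁺; any⁻)

  𝟙 : Bool → ℕ
  𝟙 b = if b then 1 else 0

  module _ {m n : ℕ} where

    <⇒<ᵇ≡true : m < n → (m <ᵇ n) ≡ true
    <⇒<ᵇ≡true m<n = Equivalence.to Bool.T-≡ (ℕ.<⇒<ᵇ m<n)

    <ᵇ≡true⇒< : (m <ᵇ n) ≡ true → m < n
    <ᵇ≡true⇒< eq = ℕ.<ᵇ⇒< m n (Equivalence.from Bool.T-≡ eq)

    ≮⇒<ᵇ≡false : ¬ m < n → (m <ᵇ n) ≡ false
    ≮⇒<ᵇ≡false m≮n with m <ᵇ n in eq
    ... | false = refl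
    ... | true  = ⊥-elim (m≮n (<ᵇ≡true⇒< eq))

    ≡ᵇ≡true⇒≡ : (m ≡ᵇ n) ≡ true → m ≡ n
    ≡ᵇ≡true⇒≡ eq = ℕ.≡ᵇ⇒≡ m n (Equivalence.from Bool.T-≡ eq)

    ≢⇒≡ᵇ≡false : m ≢ n → (m ≡ᵇ n) ≡ false
    ≢⇒≡ᵇ≡false m≢n with m ≡ᵇ n in eq
    ... | false = refl
    ... | true  = ⊥-elim (m≢n (≡ᵇ≡true⇒≡ eq))

  ≡ᵇ-refl : ∀ n → (n ≡ᵇ n) ≡ true
  ≡ᵇ-refl n = Equivalence.to Bool.T-≡ (ℕ.≡⇒≡ᵇ n n refl)

  module _ {A : Set} where

    count-++ : ∀ (p : A → Bool) xs ys → count p (xs ++ ys) ≡ count p xs + count p ys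
    count-++ p []       ys = refl
    count-++ p (x ∷ xs) ys = trans (cong (𝟙 (p x) +_) (count-++ p xs ys)) (sym (ℕ.+-assoc (𝟙 (p x)) _ _))

    count-cong : ∀ {p q : A → Bool} xs → (∀ {x} → x ∈ xs → p x ≡ q x) → count p xs ≡ count q xs
    count-cong []       _   = refl
    count-cong (x ∷ xs) p≗q = cong₂ _+_ (cong 𝟙 (p≗q (here refl))) (count-cong xs (p≗q ∘ there))

    count-↭ : ∀ (p : A → Bool) {xs ys} → xs ↭ ys → count p xs ≡ count p ys
    count-↭ p ↭.refl           = refl
    count-↭ p (prep x xs↭ys)   = cong (𝟙 (p x) +_) (count-↭ p xs↭ys)
    count-↭ p (swap x y xs↭ys) = begin
      𝟙 (p x) + (𝟙 (p y) + _) ≡⟨ ℕ.+-assoc (𝟙 (p x)) _ _ ⟨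
      𝟙 (p x) + 𝟙 (p y) + _   ≡⟨ cong₂ _+_ (ℕ.+-comm (𝟙 (p x)) (𝟙 (p y))) (count-↭ p xs↭ys) ⟩
      𝟙 (p y) + 𝟙 (p x) + _   ≡⟨ ℕ.+-assoc (𝟙 (p y)) _ _ ⟩
      𝟙 (p y) + (𝟙 (p x) + _) ∎
      where
      open ≡-Reasoning
    count-↭ p (↭.trans r₁ r₂) = trans (count-↭ p r₁) (count-↭ p r₂)

    count-map : ∀ {B : Set} (p : B → Bool) (f : A → B) xs → count p (map f xs) ≡ count (p ∘ f) xs
    count-map p f []       = refl
    count-map p f (x ∷ xs) = cong (𝟙 (p (f x)) +_) (count-map p f xs)

    count-partition₃ : ∀ (p q r d : A → Bool) xs →
                       (∀ {x} → x ∈ xs → 𝟙 (p x) + 𝟙 (q x) + 𝟙 (r x) ≡ 𝟙 (d x)) →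
                       count p xs + count q xs + count r xs ≡ count d xs
    count-partition₃ p q r d []       _     = refl
    count-partition₃ p q r d (x ∷ xs) split =
      trans (regroup (𝟙 (p x)) (𝟙 (q x)) (𝟙 (r x)) (count p xs) (count q xs) (count r xs))
            (cong₂ _+_ (split (here refl)) (count-partition₃ p q r d xs (split ∘ there)))
      where
      open +-*-Solver
      regroup : ∀ a b c k l n → a + k + (b + l) + (c + n) ≡ a + b + c + (k + l + n)
      regroup = solve 6 (λ a b c k l n → a :+ k :+ (b :+ l) :+ (c :+ n) := a :+ b :+ c :+ (k :+ l :+ n)) refl

  count-≡ᵇ-unique : ∀ {v xs} → Unique xs → v ∈ xs → count (_≡ᵇ v) xs ≡ 1
  count-≡ᵇ-unique {v} {x ∷ xs} (x∉xs ∷ _) (here refl) rewrite ≡ᵇ-refl x =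
    cong suc (trans (count-cong xs (λ y∈ → ≢⇒≡ᵇ≡false (All.lookup x∉xs y∈ ∘ sym))) (count-false xs))
    where
    count-false : ∀ (ys : List ℕ) → count (λ _ → false) ys ≡ 0
    count-false []       = refl
    count-false (_ ∷ ys) = count-false ys
  count-≡ᵇ-unique {v} {x ∷ xs} (x∉xs ∷ uxs) (there v∈) rewrite ≢⇒≡ᵇ≡false (All.lookup x∉xs v∈) =
    count-≡ᵇ-unique uxs v∈

  -- Adjacent pairs, with the convention π(n+1) = 0

  pairs₀ : List ℕ → List (ℕ × ℕ)
  pairs₀ π = pairs (π ++ [ 0 ])

  next : List ℕ → ℕ
  next []      = 0
  next (b ∷ _) = b

  pairs₀-∷ : ∀ a q → pairs₀ (a ∷ q) ≡ (a , next q) ∷ pairs₀ q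
  pairs₀-∷ a []      = refl
  pairs₀-∷ a (b ∷ q) = refl

  pairs-++-∷ : ∀ p a c → pairs (p ++ a ∷ c) ≡ pairs (p ++ [ a ]) ++ pairs (a ∷ c)
  pairs-++-∷ []          a c = refl
  pairs-++-∷ (u ∷ [])    a c = refl
  pairs-++-∷ (u ∷ v ∷ p) a c = cong ((u , v) ∷_) (pairs-++-∷ (v ∷ p) a c)

  pairs₀-split : ∀ p a q → pairs₀ (p ++ a ∷ q) ≡ pairs (p ++ [ a ]) ++ (a , next q) ∷ pairs₀ q
  pairs₀-split p a q rewrite List.++-assoc p (a ∷ q) [ 0 ] | pairs-++-∷ p a (q ++ [ 0 ]) | pairs₀-∷ a q = refl

  pairs₀-insert : ∀ X p a q →
                  pairs₀ (p ++ a ∷ X ∷ q) ≡ pairs (p ++ [ a ]) ++ (a , X) ∷ (X , next q) ∷ pairs₀ q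
  pairs₀-insert X p a q =
    trans (pairs₀-split p a (X ∷ q)) (cong (λ r → pairs (p ++ [ a ]) ++ (a , X) ∷ r) (pairs₀-∷ X q))

  map-proj₁-pairs-∷ʳ : ∀ c π → map proj₁ (pairs (π ++ [ c ])) ≡ π
  map-proj₁-pairs-∷ʳ c []          = refl
  map-proj₁-pairs-∷ʳ c (a ∷ [])    = refl
  map-proj₁-pairs-∷ʳ c (a ∷ b ∷ π) = cong (a ∷_) (map-proj₁-pairs-∷ʳ c (b ∷ π))

  proj₁-∈-pairs-∷ʳ : ∀ c π {e} → e ∈ pairs (π ++ [ c ]) → proj₁ e ∈ π
  proj₁-∈-pairs-∷ʳ c π e∈ = subst (_ ∈_) (map-proj₁-pairs-∷ʳ c π) (∈-map⁺ proj₁ e∈)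

  ∈-pairs : ∀ w {e} → e ∈ pairs w → proj₁ e ∈ w × proj₂ e ∈ w
  ∈-pairs (a ∷ b ∷ w) (here refl) = here refl , there (here refl)
  ∈-pairs (a ∷ b ∷ w) (there e∈)  with ∈-pairs (b ∷ w) e∈
  ... | a∈ , b∈ = there a∈ , there b∈

  ∈-pairs-≢ : ∀ w → Unique w → ∀ {e} → e ∈ pairs w → proj₁ e ≢ proj₂ e
  ∈-pairs-≢ (a ∷ b ∷ w) ((a≢b ∷ _) ∷ _) (here refl) = a≢b
  ∈-pairs-≢ (a ∷ b ∷ w) (_ ∷ uw)        (there e∈)  = ∈-pairs-≢ (b ∷ w) uw e∈

  count-insert : ∀ (f : ℕ × ℕ → Bool) X p a q →
    𝟙 (f (a , next q)) + count f (pairs₀ (p ++ a ∷ X ∷ q))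
      ≡ 𝟙 (f (a , X)) + 𝟙 (f (X , next q)) + count f (pairs₀ (p ++ a ∷ q))
  count-insert f X p a q
    rewrite pairs₀-insert X p a q | pairs₀-split p a q
          | count-++ f (pairs (p ++ [ a ])) ((a , X) ∷ (X , next q) ∷ pairs₀ q)
          | count-++ f (pairs (p ++ [ a ])) ((a , next q) ∷ pairs₀ q) =
    regroup (count f (pairs (p ++ [ a ]))) (𝟙 (f (a , X))) (𝟙 (f (X , next q))) (𝟙 (f (a , next q)))
            (count f (pairs₀ q))
    where
    open +-*-Solver
    regroup : ∀ k x y z l → z + (k + (x + (y + l))) ≡ x + y + (k + (z + l))
    regroup = solve 5 (λ k x y z l → z :+ (k :+ (x :+ (y :+ l))) := x :+ y :+ (k :+ (z :+ l))) refl

  lastOf : ℕ → List ℕ → ℕ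
  lastOf z []      = z
  lastOf z (b ∷ w) = lastOf b w

  lastOf-∈ : ∀ z w → lastOf z w ∈ z ∷ w
  lastOf-∈ z []      = here refl
  lastOf-∈ z (b ∷ w) = there (lastOf-∈ b w)

  count-pairs₀ : ∀ (f : ℕ × ℕ → Bool) z w →
                 count f (pairs₀ (z ∷ w)) ≡ count f (pairs (z ∷ w)) + 𝟙 (f (lastOf z w , 0))
  count-pairs₀ f z w = begin
    count f (pairs₀ (z ∷ w))                                   ≡⟨ cong (count f) (pairs-∷ʳ z w) ⟩
    count f (pairs (z ∷ w) ++ [ (lastOf z w , 0) ])           ≡⟨ count-++ f (pairs (z ∷ w)) _ ⟩
    count f (pairs (z ∷ w)) + (𝟙 (f (lastOf z w , 0)) + 0)  ≡⟨ cong (count f (pairs (z ∷ w)) +_) (ℕ.+-identityʳ _) ⟩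
    count f (pairs (z ∷ w)) + 𝟙 (f (lastOf z w , 0))        ∎
    where
    pairs-∷ʳ : ∀ z w → pairs ((z ∷ w) ++ [ 0 ]) ≡ pairs (z ∷ w) ++ [ (lastOf z w , 0) ]
    pairs-∷ʳ z []      = refl
    pairs-∷ʳ z (b ∷ w) = cong ((z , b) ∷_) (pairs-∷ʳ b w)
    open ≡-Reasoning

  isSucc isBigAscent : ℕ × ℕ → Bool
  isSucc      (a , b) = b ≡ᵇ suc a
  isBigAscent (a , b) = suc a <ᵇ b

  ascent⇒¬descent : ∀ {a h} → a < h → isDescent (a , h) ≡ false
  ascent⇒¬descent a<h = ≮⇒<ᵇ≡false (ℕ.<⇒≯ a<h)

  descent⇒¬succ : ∀ {a h} → h < a → isSucc (a , h) ≡ false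
  descent⇒¬succ {a} {h} h<a = ≢⇒≡ᵇ≡false {h} {suc a} (λ { refl → ℕ.<-asym h<a (ℕ.n<1+n a) })

  descent⇒¬bigAscent : ∀ {a h} → h < a → isBigAscent (a , h) ≡ false
  descent⇒¬bigAscent {a} h<a = ≮⇒<ᵇ≡false (λ a+1<h → ℕ.<-asym h<a (ℕ.<-trans (ℕ.n<1+n a) a+1<h))

  basc-pairs₀ : ∀ π → count isBigAscent (pairs₀ π) ≡ basc π
  basc-pairs₀ []      = refl
  basc-pairs₀ (z ∷ w) = trans (count-pairs₀ isBigAscent z w) (ℕ.+-identityʳ _)

  sucs-pairs₀ : ∀ π → count isSucc (pairs₀ π) ≡ sucs π
  sucs-pairs₀ []      = refl
  sucs-pairs₀ (z ∷ w) = trans (count-pairs₀ isSucc z w) (ℕ.+-identityʳ _)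

  des-pairs₀ : ∀ {v} l → v ∈ l → (∀ {u} → u ∈ l → 1 ≤ u) → count isDescent (pairs₀ l) ≡ suc (des l)
  des-pairs₀ (z ∷ w) _ positive rewrite count-pairs₀ isDescent z w | <⇒<ᵇ≡true (positive (lastOf-∈ z w)) =
    ℕ.+-comm _ 1

  next-≤ : ∀ {m} l → (∀ {v} → v ∈ l → v ≤ m) → next l ≤ m
  next-≤ []      _     = z≤n
  next-≤ (b ∷ _) bound = bound (here refl)

  -- Proper left-to-right minima

  any-++ : ∀ {A : Set} (p : A → Bool) xs ys → any p (xs ++ ys) ≡ any p xs ∨ any p ys
  any-++ p []       ys = refl
  any-++ p (x ∷ xs) ys = trans (cong (p x ∨_) (any-++ p xs ys)) (sym (Bool.∨-assoc (p x) _ _))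

  all-++ : ∀ {A : Set} (p : A → Bool) xs ys → all p (xs ++ ys) ≡ all p xs ∧ all p ys
  all-++ p []       ys = refl
  all-++ p (x ∷ xs) ys = trans (cong (p x ∧_) (all-++ p xs ys)) (sym (Bool.∧-assoc (p x) _ _))

  descendsFrom : ℕ → ℕ × ℕ → Bool
  descendsFrom v (a , b) = (a ≡ᵇ v ∸ 1) ∧ (b <ᵇ a)

  isLRMin : List ℕ → ℕ → Bool
  isLRMin pre v = all (v <ᵇ_) pre

  -- The summand of plrminGo pre (v ∷ rest) for v is definitionally 𝟙 (isProperAt pre v rest).
  isProperAt : List ℕ → ℕ → List ℕ → Bool
  isProperAt pre v rest = isLRMin pre v ∧ not (v ≡ᵇ 1) ∧ any (descendsFrom v) (pairs₀ rest)

  isProper : List ℕ → List ℕ → ℕ → Bool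
  isProper pre []         v = false
  isProper pre (u ∷ rest) v = if u ≡ᵇ v then isProperAt pre u rest else isProper (pre ++ [ u ]) rest v

  isLRMin-∷ʳ : ∀ pre u w → isLRMin (pre ++ [ u ]) w ≡ isLRMin pre w ∧ (w <ᵇ u)
  isLRMin-∷ʳ pre u w = trans (all-++ (w <ᵇ_) pre [ u ]) (cong (isLRMin pre w ∧_) (Bool.∧-identityʳ (w <ᵇ u)))

  isLRMin-∷ʳ-cong : ∀ pre pre' u {w} → isLRMin pre w ≡ isLRMin pre' w →
                    isLRMin (pre ++ [ u ]) w ≡ isLRMin (pre' ++ [ u ]) w
  isLRMin-∷ʳ-cong pre pre' u {w} eq =
    trans (isLRMin-∷ʳ pre u w) (trans (cong (_∧ (w <ᵇ u)) eq) (sym (isLRMin-∷ʳ pre' u w)))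

  plrminGo-cong : ∀ pre pre' l → (∀ {w} → w ∈ l → isLRMin pre w ≡ isLRMin pre' w) →
                  plrminGo pre l ≡ plrminGo pre' l
  plrminGo-cong pre pre' []         _  = refl
  plrminGo-cong pre pre' (v ∷ rest) eq =
    cong₂ _+_ (cong (λ b → 𝟙 (b ∧ not (v ≡ᵇ 1) ∧ any (descendsFrom v) (pairs₀ rest))) (eq (here refl)))
              (plrminGo-cong (pre ++ [ v ]) (pre' ++ [ v ]) rest (isLRMin-∷ʳ-cong pre pre' v ∘ eq ∘ there))

  plrminGo-∷ʳ-larger : ∀ pre u l → All (_< u) l → plrminGo (pre ++ [ u ]) l ≡ plrminGo pre l
  plrminGo-∷ʳ-larger pre u l l<u = plrminGo-cong (pre ++ [ u ]) pre l (λ {w} w∈ →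
    trans (isLRMin-∷ʳ pre u w)
          (trans (cong (isLRMin pre w ∧_) (<⇒<ᵇ≡true (All.lookup l<u w∈))) (Bool.∧-identityʳ _)))

  isProper-∉ : ∀ pre l v → v ∉ l → isProper pre l v ≡ false
  isProper-∉ pre []         v _   = refl
  isProper-∉ pre (u ∷ rest) v v∉ rewrite ≢⇒≡ᵇ≡false {u} {v} (v∉ ∘ here ∘ sym) =
    isProper-∉ (pre ++ [ u ]) rest v (v∉ ∘ there)

  isProper-notLRMin : ∀ pre l v → isLRMin pre v ≡ false → isProper pre l v ≡ false
  isProper-notLRMin pre []         v _ = refl
  isProper-notLRMin pre (u ∷ rest) v notMin with u ℕ.≟ v
  ... | yes refl rewrite ≡ᵇ-refl u | notMin = refl
  ... | no  u≢v  rewrite ≢⇒≡ᵇ≡false u≢v =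
    isProper-notLRMin (pre ++ [ u ]) rest v (trans (isLRMin-∷ʳ pre u v) (cong (_∧ (v <ᵇ u)) notMin))

  isProper-1 : ∀ pre l → isProper pre l 1 ≡ false
  isProper-1 pre []         = refl
  isProper-1 pre (u ∷ rest) with u ℕ.≟ 1
  ... | yes refl = lemma (isLRMin pre 1)
    where
    lemma : ∀ b → b ∧ false ∧ any (descendsFrom 1) (pairs₀ rest) ≡ false
    lemma true  = refl
    lemma false = refl
  ... | no  u≢1  rewrite ≢⇒≡ᵇ≡false u≢1 = isProper-1 (pre ++ [ u ]) rest

  isProper⇒descends : ∀ pre l v → isProper pre l v ≡ true → any (descendsFrom v) (pairs₀ l) ≡ true
  isProper⇒descends pre (u ∷ rest) v proper rewrite pairs₀-∷ u rest with u ℕ.≟ v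
  ... | yes refl rewrite ≡ᵇ-refl u =
    trans (cong (descendsFrom u (u , next rest) ∨_)
                (∧≡true⇒ʳ (not (u ≡ᵇ 1)) (∧≡true⇒ʳ (isLRMin pre u) proper)))
          (Bool.∨-zeroʳ _)
    where
    ∧≡true⇒ʳ : ∀ x {y} → x ∧ y ≡ true → y ≡ true
    ∧≡true⇒ʳ true eq = eq
  ... | no  u≢v  rewrite ≢⇒≡ᵇ≡false u≢v =
    trans (cong (descendsFrom v (u , next rest) ∨_) (isProper⇒descends (pre ++ [ u ]) rest v proper)) (Bool.∨-zeroʳ _)

  isProper-head : ∀ pre v rest → isProper pre (v ∷ rest) v ≡ isProperAt pre v rest
  isProper-head pre v rest rewrite ≡ᵇ-refl v = refl

  isProper-tail : ∀ pre {u v} rest → u ≢ v → isProper pre (u ∷ rest) v ≡ isProper (pre ++ [ u ]) rest v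
  isProper-tail pre rest u≢v rewrite ≢⇒≡ᵇ≡false u≢v = refl

  plrminGo-count : ∀ pre l → Unique l → plrminGo pre l ≡ count (isProper pre l) l
  plrminGo-count pre []         _             = refl
  plrminGo-count pre (u ∷ rest) (u∉ ∷ urest) rewrite ≡ᵇ-refl u =
    cong (𝟙 (isProperAt pre u rest) +_)
         (trans (plrminGo-count (pre ++ [ u ]) rest urest)
                (count-cong rest (λ {w} w∈ → sym (isProper-tail pre rest (All.lookup u∉ w∈)))))

  Unique-middle : ∀ (p : List ℕ) a q → Unique (p ++ a ∷ q) → a ∉ p × a ∉ q
  Unique-middle []      a q (a∉q ∷ _) = (λ ()) , (λ a∈ → All.lookup a∉q a∈ refl)
  Unique-middle (u ∷ p) a q (u∉ ∷ uniq) with Unique-middle p a q uniq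
  ... | a∉p , a∉q =
    (λ { (here refl) → All.lookup u∉ (∈-++⁺ʳ p (here refl)) refl ; (there a∈p) → a∉p a∈p }) , a∉q

  none-descendsFrom : ∀ v es → (∀ {e} → e ∈ es → proj₁ e ≢ v ∸ 1) → any (descendsFrom v) es ≡ false
  none-descendsFrom v []             _      = refl
  none-descendsFrom v ((a , b) ∷ es) a≢v-1 rewrite ≢⇒≡ᵇ≡false (a≢v-1 (here refl)) =
    none-descendsFrom v es (a≢v-1 ∘ there)

  any-descendsFrom-insert : ∀ X u p a q → 1 ≤ u → u < X → u ≢ suc a →
    any (descendsFrom u) (pairs₀ (p ++ a ∷ X ∷ q)) ≡ any (descendsFrom u) (pairs₀ (p ++ a ∷ q))
  any-descendsFrom-insert X (suc u) p a q _ u<X u≢a+1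
    rewrite pairs₀-insert X p a q | pairs₀-split p a q
          | any-++ (descendsFrom (suc u)) (pairs (p ++ [ a ])) ((a , X) ∷ (X , next q) ∷ pairs₀ q)
          | any-++ (descendsFrom (suc u)) (pairs (p ++ [ a ])) ((a , next q) ∷ pairs₀ q)
          | ≢⇒≡ᵇ≡false {a} {u} (u≢a+1 ∘ cong suc ∘ sym)
          | ≢⇒≡ᵇ≡false {X} {u} (λ X≡u → ℕ.<-irrefl (sym X≡u) (ℕ.<-trans (ℕ.n<1+n u) u<X)) = refl

  any-descendsFrom-insert-suc : ∀ X p a q → a ∉ p → a ∉ q → a < X →
    any (descendsFrom (suc a)) (pairs₀ (p ++ a ∷ X ∷ q)) ≡ false
  any-descendsFrom-insert-suc X p a q a∉p a∉q a<X
    rewrite pairs₀-insert X p a q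
          | any-++ (descendsFrom (suc a)) (pairs (p ++ [ a ])) ((a , X) ∷ (X , next q) ∷ pairs₀ q)
          | none-descendsFrom (suc a) (pairs (p ++ [ a ]))
              (λ e∈ e≡a → a∉p (subst (_∈ p) e≡a (proj₁-∈-pairs-∷ʳ a p e∈)))
          | ≡ᵇ-refl a | ≮⇒<ᵇ≡false (ℕ.<⇒≯ a<X) | ≢⇒≡ᵇ≡false {X} {a} (ℕ.>⇒≢ a<X)
          | none-descendsFrom (suc a) (pairs₀ q)
              (λ e∈ e≡a → a∉q (subst (_∈ q) e≡a (proj₁-∈-pairs-∷ʳ 0 q e∈))) = refl

  isProperAt-cong : ∀ pre v rest rest' → any (descendsFrom v) (pairs₀ rest) ≡ any (descendsFrom v) (pairs₀ rest') →
                    isProperAt pre v rest ≡ isProperAt pre v rest'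
  isProperAt-cong pre v _ _ eq = cong (λ b → isLRMin pre v ∧ not (v ≡ᵇ 1) ∧ b) eq

  isProperAt-notLRMin : ∀ pre v rest → isLRMin pre v ≡ false → isProperAt pre v rest ≡ false
  isProperAt-notLRMin pre v rest notMin = cong (λ b → b ∧ not (v ≡ᵇ 1) ∧ any (descendsFrom v) (pairs₀ rest)) notMin

  isProperAt-noDescent : ∀ pre v rest → any (descendsFrom v) (pairs₀ rest) ≡ false → isProperAt pre v rest ≡ false
  isProperAt-noDescent pre v rest none =
    trans (isProperAt-cong pre v rest [] none) (trans (cong (isLRMin pre v ∧_) (Bool.∧-zeroʳ _)) (Bool.∧-zeroʳ _))

  isLRMin-∷ʳ-smaller : ∀ pre {u w} → u < w → isLRMin (pre ++ [ u ]) w ≡ false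
  isLRMin-∷ʳ-smaller pre {u} {w} u<w =
    trans (isLRMin-∷ʳ pre u w) (trans (cong (isLRMin pre w ∧_) (≮⇒<ᵇ≡false (ℕ.<⇒≯ u<w))) (Bool.∧-zeroʳ _))

  plrminGo-insert-head : ∀ X pre a q → a < X → All (_< X) q →
    plrminGo pre (a ∷ X ∷ q) + 𝟙 (isProper pre (a ∷ q) (suc a)) ≡ plrminGo pre (a ∷ q)
  plrminGo-insert-head X pre a q a<X q<X = begin
    𝟙 (isProperAt pre a (X ∷ q)) + (𝟙 (isProperAt (pre ++ [ a ]) X q) + plrminGo ((pre ++ [ a ]) ++ [ X ]) q)
      + 𝟙 (isProper pre (a ∷ q) (suc a))
      ≡⟨ cong₂ _+_ (cong₂ _+_ (cong 𝟙 X-no-descent)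
                              (cong₂ _+_ (cong 𝟙 (isProperAt-notLRMin (pre ++ [ a ]) X q (isLRMin-∷ʳ-smaller pre a<X)))
                                         (plrminGo-∷ʳ-larger (pre ++ [ a ]) X q q<X)))
                   (cong 𝟙 (trans (isProper-tail pre q (ℕ.1+n≢n ∘ sym))
                                  (isProper-notLRMin (pre ++ [ a ]) q (suc a) (isLRMin-∷ʳ-smaller pre (ℕ.n<1+n a))))) ⟩
    𝟙 (isProperAt pre a q) + (0 + plrminGo (pre ++ [ a ]) q) + 0
      ≡⟨ ℕ.+-identityʳ _ ⟩
    plrminGo pre (a ∷ q) ∎
    where
    open ≡-Reasoning
    X-no-descent : isProperAt pre a (X ∷ q) ≡ isProperAt pre a q
    X-no-descent = isProperAt-cong pre a (X ∷ q) q (trans (cong (any (descendsFrom a)) (pairs₀-∷ X q))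
      (cong (λ b → (b ∧ (next q <ᵇ X)) ∨ any (descendsFrom a) (pairs₀ q))
            (≢⇒≡ᵇ≡false (λ X≡ → ℕ.<-irrefl (sym X≡) (ℕ.≤-<-trans (ℕ.m∸n≤m a 1) a<X)))))

  plrminGo-insert : ∀ X pre p a q → Unique (p ++ a ∷ q) → All (λ v → 1 ≤ v × v < X) (p ++ a ∷ q) →
    plrminGo pre (p ++ a ∷ X ∷ q) + 𝟙 (isProper pre (p ++ a ∷ q) (suc a)) ≡ plrminGo pre (p ++ a ∷ q)
  plrminGo-insert X pre [] a q _ ((_ , a<X) ∷ q-range) =
    plrminGo-insert-head X pre a q a<X (All.map proj₂ q-range)
  plrminGo-insert X pre (u ∷ p) a q (u∉ ∷ uniq) ((1≤u , u<X) ∷ range) with u ℕ.≟ suc a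
  ... | yes refl = begin
    𝟙 (isProperAt pre (suc a) w) + plrminGo pre' w + 𝟙 (isProper pre (suc a ∷ π') (suc a))
      ≡⟨ cong₂ (λ b c → 𝟙 b + plrminGo pre' w + 𝟙 c)
               (isProperAt-noDescent pre (suc a) w (any-descendsFrom-insert-suc X p a q a∉p a∉q a<X))
               (isProper-head pre (suc a) π') ⟩
    plrminGo pre' w + 𝟙 (isProperAt pre (suc a) π')
      ≡⟨ ℕ.+-comm _ (𝟙 (isProperAt pre (suc a) π')) ⟩
    𝟙 (isProperAt pre (suc a) π') + plrminGo pre' w
      ≡⟨ cong (𝟙 (isProperAt pre (suc a) π') +_) (trans (sym (ℕ.+-identityʳ _)) IH) ⟩
    plrminGo pre (suc a ∷ π') ∎
    where
    open ≡-Reasoning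
    w    = p ++ a ∷ X ∷ q
    π'   = p ++ a ∷ q
    pre' = pre ++ [ suc a ]
    a∉p  = proj₁ (Unique-middle p a q uniq)
    a∉q  = proj₂ (Unique-middle p a q uniq)
    a<X  = proj₂ (All.lookup range (∈-++⁺ʳ p (here refl)))
    IH : plrminGo pre' w + 0 ≡ plrminGo pre' π'
    IH = subst (λ b → plrminGo pre' w + 𝟙 b ≡ plrminGo pre' π')
               (isProper-∉ pre' π' (suc a) (λ a+1∈ → All.lookup u∉ a+1∈ refl))
               (plrminGo-insert X pre' p a q uniq range)
  ... | no u≢a+1 = begin
    𝟙 (isProperAt pre u w) + plrminGo pre' w + 𝟙 (isProper pre (u ∷ π') (suc a))
      ≡⟨ cong₂ (λ b c → 𝟙 b + plrminGo pre' w + 𝟙 c)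
               (isProperAt-cong pre u w π' (any-descendsFrom-insert X u p a q 1≤u u<X u≢a+1))
               (isProper-tail pre π' u≢a+1) ⟩
    𝟙 (isProperAt pre u π') + plrminGo pre' w + 𝟙 (isProper pre' π' (suc a))
      ≡⟨ ℕ.+-assoc (𝟙 (isProperAt pre u π')) _ _ ⟩
    𝟙 (isProperAt pre u π') + (plrminGo pre' w + 𝟙 (isProper pre' π' (suc a)))
      ≡⟨ cong (𝟙 (isProperAt pre u π') +_) (plrminGo-insert X pre' p a q uniq range) ⟩
    plrminGo pre (u ∷ π') ∎
    where
    open ≡-Reasoning
    w    = p ++ a ∷ X ∷ q
    π'   = p ++ a ∷ q
    pre' = pre ++ [ u ]

  -- Inserting a new maximum

  Split : Set
  Split = List ℕ × ℕ × List ℕ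

  splits : List ℕ → List Split
  splits []      = []
  splits (a ∷ q) = ([] , a , q) ∷ map (λ { (p , b , r) → a ∷ p , b , r }) (splits q)

  insertAfter : ℕ → Split → List ℕ
  insertAfter X (p , a , q) = p ++ a ∷ X ∷ q

  pairAt : Split → ℕ × ℕ
  pairAt (p , a , q) = a , next q

  insertions-splits : ∀ X π → insertions X π ≡ (X ∷ π) ∷ map (insertAfter X) (splits π)
  insertions-splits X []      = refl
  insertions-splits X (a ∷ q) rewrite insertions-splits X q =
    cong (λ ws → (X ∷ a ∷ q) ∷ (a ∷ X ∷ q) ∷ ws) (trans (sym (List.map-∘ (splits q))) (List.map-∘ (splits q)))

  ∈-splits : ∀ π {p a q} → (p , a , q) ∈ splits π → π ≡ p ++ a ∷ q
  ∈-splits (a ∷ q) (here refl) = refl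
  ∈-splits (a ∷ q) (there t∈) with ∈-map⁻ _ t∈
  ... | _ , t'∈ , refl = cong (a ∷_) (∈-splits q t'∈)

  map-pairAt-splits : ∀ π → map pairAt (splits π) ≡ pairs₀ π
  map-pairAt-splits []      = refl
  map-pairAt-splits (a ∷ q) rewrite pairs₀-∷ a q =
    cong ((a , next q) ∷_) (trans (sym (List.map-∘ (splits q))) (map-pairAt-splits q))

  Stats : Set
  Stats = ℕ × ℕ × ℕ × ℕ

  stats : List ℕ → Stats
  stats π = basc π , des π ∸ plrmin π , sucs π , plrmin π

  -- The kind of the pair (a , h) of pairs₀ π after whose first letter the new maximum is inserted:
  -- h = a + 1, h ≥ a + 2, a = max π, a + 1 is a proper left-to-right minimum, or any other descent.
  data Kind : Set where
    succession bigAscent maxLetter properMin plainDescent : Kind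

  shift : Kind → Stats → Stats
  shift succession   (A , B , C , P) = suc A , suc B , C ∸ 1 , P
  shift bigAscent    (A , B , C , P) = A , suc B , C , P
  shift maxLetter    (A , B , C , P) = A , B , suc C , P
  shift properMin    (A , B , C , P) = suc A , suc B , C , P ∸ 1
  shift plainDescent (A , B , C , P) = suc A , B , C , P

  multiplicity : Kind → Stats → ℕ
  multiplicity succession   (A , B , C , P) = C
  multiplicity bigAscent    (A , B , C , P) = A
  multiplicity maxLetter    _               = 1
  multiplicity properMin    (A , B , C , P) = P
  multiplicity plainDescent (A , B , C , P) = B

  record Shape : Set where
    constructor shape
    field
      succ bigAsc desc atMax succProper : Bool
  open Shape

  shapeOf : Kind → Shape
  shapeOf succession   = shape true  false false false false
  shapeOf bigAscent    = shape false true  false false false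
  shapeOf maxLetter    = shape false false true  true  false
  shapeOf properMin    = shape false false true  false true
  shapeOf plainDescent = shape false false true  false false

  component : Kind → Shape → Bool
  component succession   = succ
  component bigAscent    = bigAsc
  component maxLetter    = atMax
  component properMin    = succProper
  component plainDescent σ = desc σ ∧ not (atMax σ) ∧ not (succProper σ)

  -- is k k' holds iff k' = k, since component k is true on shapeOf k and false on the other shapes.
  is : Kind → Kind → Bool
  is k = component k ∘ shapeOf

  descents-partition : ∀ k → 𝟙 (atMax (shapeOf k)) + 𝟙 (succProper (shapeOf k))
                             + 𝟙 (component plainDescent (shapeOf k)) ≡ 𝟙 (desc (shapeOf k))
  descents-partition succession   = refl
  descents-partition bigAscent    = refl
  descents-partition maxLetter    = refl
  descents-partition properMin    = refl
  descents-partition plainDescent = refl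

  kindOf : Shape → Kind
  kindOf σ = if succ σ then succession else if bigAsc σ then bigAscent
             else if atMax σ then maxLetter else if succProper σ then properMin else plainDescent

  shape-cong : ∀ {a b c d e a' b' c' d' e'} → a ≡ a' → b ≡ b' → c ≡ c' → d ≡ d' → e ≡ e' →
               shape a b c d e ≡ shape a' b' c' d' e'
  shape-cong refl refl refl refl refl = refl

  kindOf-shapeOf : ∀ k → kindOf (shapeOf k) ≡ k
  kindOf-shapeOf succession   = refl
  kindOf-shapeOf bigAscent    = refl
  kindOf-shapeOf maxLetter    = refl
  kindOf-shapeOf properMin    = refl
  kindOf-shapeOf plainDescent = refl

  stats-cong₂ : ∀ {A B B' C P : ℕ} → B ≡ B' → (A , B , C , P) ≡ (A , B' , C , P)
  stats-cong₂ refl = refl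

  shift-stats : ∀ k {σ A C D P A' C' D' P'} → σ ≡ shapeOf k → P ≤ D →
    𝟙 (bigAsc σ) + A' ≡ 𝟙 (not (atMax σ)) + A →
    𝟙 (succ σ) + C' ≡ 𝟙 (atMax σ) + C →
    𝟙 (desc σ) + D' ≡ 1 + D →
    𝟙 (succProper σ) + P' ≡ P →
    (A' , D' ∸ P' , C' , P') ≡ shift k (A , D ∸ P , C , P)
  shift-stats succession   refl P≤D refl refl refl refl = stats-cong₂ (ℕ.+-∸-assoc 1 P≤D)
  shift-stats bigAscent    refl P≤D refl refl refl refl = stats-cong₂ (ℕ.+-∸-assoc 1 P≤D)
  shift-stats maxLetter    refl _   refl refl refl refl = refl
  shift-stats properMin {D = D} {P' = P'} refl P'<D refl refl refl refl = stats-cong₂ (∸-suc D P' P'<D)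
    where
    ∸-suc : ∀ D P' → suc P' ≤ D → D ∸ P' ≡ suc (D ∸ suc P')
    ∸-suc (suc D) zero     _          = refl
    ∸-suc (suc D) (suc P') (s≤s P'<D) = ∸-suc D P' P'<D
  shift-stats plainDescent refl _   refl refl refl refl = refl

  basc-insert : ∀ m p a q → a ≤ m → next q ≤ m →
    𝟙 (isBigAscent (a , next q)) + basc (p ++ a ∷ suc m ∷ q) ≡ 𝟙 (not (a ≡ᵇ m)) + basc (p ++ a ∷ q)
  basc-insert m p a q a≤m h≤m = begin
    𝟙 (isBigAscent (a , next q)) + basc (p ++ a ∷ suc m ∷ q)
      ≡⟨ cong (𝟙 (isBigAscent (a , next q)) +_) (basc-pairs₀ (p ++ a ∷ suc m ∷ q)) ⟨
    𝟙 (isBigAscent (a , next q)) + count isBigAscent (pairs₀ (p ++ a ∷ suc m ∷ q))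
      ≡⟨ count-insert isBigAscent (suc m) p a q ⟩
    𝟙 (a <ᵇ m) + 𝟙 (suc (suc m) <ᵇ next q) + count isBigAscent (pairs₀ (p ++ a ∷ q))
      ≡⟨ cong₂ (λ b c → 𝟙 b + 𝟙 c + count isBigAscent (pairs₀ (p ++ a ∷ q))) (<ᵇ≡not≡ᵇ a≤m)
               (≮⇒<ᵇ≡false (λ X<h → ℕ.<-asym (s≤s h≤m) (ℕ.<-trans (ℕ.n<1+n _) X<h))) ⟩
    𝟙 (not (a ≡ᵇ m)) + 0 + count isBigAscent (pairs₀ (p ++ a ∷ q))
      ≡⟨ cong₂ _+_ (ℕ.+-identityʳ _) (basc-pairs₀ (p ++ a ∷ q)) ⟩
    𝟙 (not (a ≡ᵇ m)) + basc (p ++ a ∷ q) ∎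
    where
    open ≡-Reasoning
    <ᵇ≡not≡ᵇ : ∀ {a m} → a ≤ m → (a <ᵇ m) ≡ not (a ≡ᵇ m)
    <ᵇ≡not≡ᵇ {a} {m} a≤m with a ℕ.≟ m
    ... | yes refl rewrite ≡ᵇ-refl a = ≮⇒<ᵇ≡false (ℕ.n≮n a)
    ... | no  a≢m  rewrite ≢⇒≡ᵇ≡false a≢m = <⇒<ᵇ≡true (ℕ.≤∧≢⇒< a≤m a≢m)

  sucs-insert : ∀ m p a q → next q ≤ m →
    𝟙 (isSucc (a , next q)) + sucs (p ++ a ∷ suc m ∷ q) ≡ 𝟙 (a ≡ᵇ m) + sucs (p ++ a ∷ q)
  sucs-insert m p a q h≤m = begin
    𝟙 (isSucc (a , next q)) + sucs (p ++ a ∷ suc m ∷ q)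
      ≡⟨ cong (𝟙 (isSucc (a , next q)) +_) (sucs-pairs₀ (p ++ a ∷ suc m ∷ q)) ⟨
    𝟙 (isSucc (a , next q)) + count isSucc (pairs₀ (p ++ a ∷ suc m ∷ q))
      ≡⟨ count-insert isSucc (suc m) p a q ⟩
    𝟙 (m ≡ᵇ a) + 𝟙 (next q ≡ᵇ suc (suc m)) + count isSucc (pairs₀ (p ++ a ∷ q))
      ≡⟨ cong₂ (λ b c → 𝟙 b + 𝟙 c + count isSucc (pairs₀ (p ++ a ∷ q))) (≡ᵇ-sym m a)
               (≢⇒≡ᵇ≡false (λ h≡X → ℕ.<-irrefl h≡X (ℕ.<-trans (s≤s h≤m) (ℕ.n<1+n _)))) ⟩
    𝟙 (a ≡ᵇ m) + 0 + count isSucc (pairs₀ (p ++ a ∷ q))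
      ≡⟨ cong₂ _+_ (ℕ.+-identityʳ _) (sucs-pairs₀ (p ++ a ∷ q)) ⟩
    𝟙 (a ≡ᵇ m) + sucs (p ++ a ∷ q) ∎
    where
    open ≡-Reasoning
    ≡ᵇ-sym : ∀ m a → (m ≡ᵇ a) ≡ (a ≡ᵇ m)
    ≡ᵇ-sym zero    zero    = refl
    ≡ᵇ-sym zero    (suc a) = refl
    ≡ᵇ-sym (suc m) zero    = refl
    ≡ᵇ-sym (suc m) (suc a) = ≡ᵇ-sym m a

  des-insert : ∀ m p a q → a ≤ m → next q ≤ m → (∀ {v} → v ∈ p ++ a ∷ q → 1 ≤ v) →
    𝟙 (isDescent (a , next q)) + des (p ++ a ∷ suc m ∷ q) ≡ 1 + des (p ++ a ∷ q)
  des-insert m p a q a≤m h≤m positive = ℕ.suc-injective (begin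
    suc (𝟙 (isDescent (a , next q)) + des w)
      ≡⟨ ℕ.+-suc _ (des w) ⟨
    𝟙 (isDescent (a , next q)) + suc (des w)
      ≡⟨ cong (𝟙 (isDescent (a , next q)) +_) (des-pairs₀ w (∈-++⁺ʳ p (here refl)) positive-w) ⟨
    𝟙 (isDescent (a , next q)) + count isDescent (pairs₀ w)
      ≡⟨ count-insert isDescent (suc m) p a q ⟩
    𝟙 (suc m <ᵇ a) + 𝟙 (next q <ᵇ suc m) + count isDescent (pairs₀ (p ++ a ∷ q))
      ≡⟨ cong₂ (λ b c → 𝟙 b + 𝟙 c + count isDescent (pairs₀ (p ++ a ∷ q)))
               (≮⇒<ᵇ≡false (ℕ.<⇒≯ (s≤s a≤m))) (<⇒<ᵇ≡true (s≤s h≤m)) ⟩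
    1 + count isDescent (pairs₀ (p ++ a ∷ q))
      ≡⟨ cong suc (des-pairs₀ (p ++ a ∷ q) (∈-++⁺ʳ p (here refl)) positive) ⟩
    suc (1 + des (p ++ a ∷ q)) ∎)
    where
    open ≡-Reasoning
    w = p ++ a ∷ suc m ∷ q
    positive-w : ∀ {v} → v ∈ w → 1 ≤ v
    positive-w v∈ with ∈-++⁻ p v∈
    ... | inj₁ v∈p                  = positive (∈-++⁺ˡ v∈p)
    ... | inj₂ (here refl)          = positive (∈-++⁺ʳ p (here refl))
    ... | inj₂ (there (here refl))  = s≤s z≤n
    ... | inj₂ (there (there v∈q)) = positive (∈-++⁺ʳ p (there v∈q))

  plrmin-insert : ∀ X p a q → Unique (p ++ a ∷ q) → All (λ v → 1 ≤ v × v < X) (p ++ a ∷ q) →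
    𝟙 (isProper [] (p ++ a ∷ q) (suc a)) + plrmin (p ++ a ∷ X ∷ q) ≡ plrmin (p ++ a ∷ q)
  plrmin-insert X p a q uniq range = trans (ℕ.+-comm _ (plrmin (p ++ a ∷ X ∷ q))) (plrminGo-insert X [] p a q uniq range)

  module Insertion {k : ℕ} {π : List ℕ} (π∈𝔖 : π ∈ 𝔖 (suc k)) where

    m X : ℕ
    m = suc k
    X = suc m

    π-range : ∀ {v} → v ∈ π → 1 ≤ v × v ≤ m
    π-range = ∈-𝔖-range {suc k} π∈𝔖

    π-unique : Unique π
    π-unique = ∈-𝔖-unique {suc k} π∈𝔖

    m∈π : m ∈ π
    m∈π = ∈-resp-↭ (↭-sym (∈-𝔖⁻ {suc k} π∈𝔖)) (∈-oneTo⁺ (s≤s z≤n) ℕ.≤-refl)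

    X∉π : X ∉ π
    X∉π = suc∉𝔖 {suc k} π∈𝔖

    fst∈π : ∀ {e} → e ∈ pairs₀ π → proj₁ e ∈ π
    fst∈π = proj₁-∈-pairs-∷ʳ 0 π

    snd≤m : ∀ {e} → e ∈ pairs₀ π → proj₂ e ≤ m
    snd≤m e∈ with ∈-++⁻ π (proj₂ (∈-pairs (π ++ [ 0 ]) e∈))
    ... | inj₁ v∈          = proj₂ (π-range v∈)
    ... | inj₂ (here refl) = z≤n

    fst≢snd : ∀ {e} → e ∈ pairs₀ π → proj₁ e ≢ proj₂ e
    fst≢snd = ∈-pairs-≢ (π ++ [ 0 ]) (Unique.++⁺ π-unique ([] ∷ []) (λ { (0∈π , here refl) → 0∉π 0∈π }))
      where
      0∉π : 0 ∉ π
      0∉π 0∈π with π-range 0∈π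
      ... | ()

    pairs₀-fst-injective : ∀ {e e'} → e ∈ pairs₀ π → e' ∈ pairs₀ π → proj₁ e ≡ proj₁ e' → e ≡ e'
    pairs₀-fst-injective =
      Unique-map⇒injectiveOn proj₁ (subst Unique (sym (map-proj₁-pairs-∷ʳ 0 π)) π-unique)

    proper : ℕ → Bool
    proper = isProper [] π

    plrmin≡count-proper : plrmin π ≡ count proper π
    plrmin≡count-proper = plrminGo-count [] π π-unique

    proper⇒descent : ∀ {a h} → (a , h) ∈ pairs₀ π → proper (suc a) ≡ true → h < a
    proper⇒descent {a} e∈ isProper-a+1
      with find (any⁻ (descendsFrom (suc a)) (pairs₀ π)
                      (Equivalence.from Bool.T-≡ (isProper⇒descends [] π (suc a) isProper-a+1)))
    ... | (a' , h') , e'∈ , descends with Equivalence.to Bool.T-∧ descends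
    ... | a'≡a , h'<a' with pairs₀-fst-injective e∈ e'∈ (sym (ℕ.≡ᵇ⇒≡ a' a a'≡a))
    ... | refl = ℕ.<ᵇ⇒< h' a' h'<a'

    proper-ascent : ∀ {a h} → (a , h) ∈ pairs₀ π → a < h → proper (suc a) ≡ false
    proper-ascent {a} e∈ a<h with proper (suc a) in eq
    ... | false = refl
    ... | true  = ⊥-elim (ℕ.<-asym a<h (proper⇒descent e∈ eq))

    shapeAt : ℕ × ℕ → Shape
    shapeAt e = shape (isSucc e) (isBigAscent e) (isDescent e) (proj₁ e ≡ᵇ m) (proper (suc (proj₁ e)))

    kind : ℕ × ℕ → Kind
    kind = kindOf ∘ shapeAt

    ascent-below-m : ∀ {a h} → (a , h) ∈ pairs₀ π → a < h → (a ≡ᵇ m) ≡ false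
    ascent-below-m {a} e∈ a<h = ≢⇒≡ᵇ≡false {a} {m} (λ { refl → ℕ.<⇒≱ a<h (snd≤m e∈) })

    shapeAt-classified : ∀ {e} → e ∈ pairs₀ π → Σ Kind λ k → shapeAt e ≡ shapeOf k
    shapeAt-classified {a , h} e∈ with ℕ.<-cmp a h
    ... | tri≈ _ a≡h _ = ⊥-elim (fst≢snd e∈ a≡h)
    ... | tri< a<h _ _ with h ℕ.≟ suc a
    ...   | yes refl = succession ,
      shape-cong (≡ᵇ-refl a) (≮⇒<ᵇ≡false (ℕ.n≮n (suc a))) (ascent⇒¬descent a<h) (ascent-below-m e∈ a<h)
                 (proper-ascent e∈ a<h)
    ...   | no h≢a+1 = bigAscent ,
      shape-cong (≢⇒≡ᵇ≡false h≢a+1) (<⇒<ᵇ≡true (ℕ.≤∧≢⇒< a<h (h≢a+1 ∘ sym))) (ascent⇒¬descent a<h)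
                 (ascent-below-m e∈ a<h) (proper-ascent e∈ a<h)
    shapeAt-classified {a , h} e∈ | tri> _ _ h<a with a ℕ.≟ m | proper (suc a) in proper-a+1
    ... | yes refl | _     = maxLetter ,
      shape-cong (descent⇒¬succ h<a) (descent⇒¬bigAscent h<a) (<⇒<ᵇ≡true h<a) (≡ᵇ-refl m)
                 (trans (sym proper-a+1) (isProper-∉ [] π X X∉π))
    ... | no a≢m   | true  = properMin ,
      shape-cong (descent⇒¬succ h<a) (descent⇒¬bigAscent h<a) (<⇒<ᵇ≡true h<a) (≢⇒≡ᵇ≡false a≢m) refl
    ... | no a≢m   | false = plainDescent ,
      shape-cong (descent⇒¬succ h<a) (descent⇒¬bigAscent h<a) (<⇒<ᵇ≡true h<a) (≢⇒≡ᵇ≡false a≢m) refl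

    shapeAt-kind : ∀ {e} → e ∈ pairs₀ π → shapeAt e ≡ shapeOf (kind e)
    shapeAt-kind e∈ with shapeAt-classified e∈
    ... | k , σ≡ = trans σ≡ (cong shapeOf (sym (trans (cong kindOf σ≡) (kindOf-shapeOf k))))

    A C D P : ℕ
    A = basc π
    C = sucs π
    D = des π
    P = plrmin π

    π-positive : ∀ {v} → v ∈ π → 1 ≤ v
    π-positive = proj₁ ∘ π-range

    count-component : ∀ k → count (is k ∘ kind) (pairs₀ π) ≡ count (component k ∘ shapeAt) (pairs₀ π)
    count-component k = count-cong (pairs₀ π) (λ e∈ → cong (component k) (sym (shapeAt-kind e∈)))

    count-fst : ∀ (f : ℕ → Bool) → count (f ∘ proj₁) (pairs₀ π) ≡ count f π
    count-fst f = trans (sym (count-map f proj₁ (pairs₀ π))) (cong (count f) (map-proj₁-pairs-∷ʳ 0 π))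

    count-atMax : count (atMax ∘ shapeAt) (pairs₀ π) ≡ 1
    count-atMax = trans (count-fst (_≡ᵇ m)) (count-≡ᵇ-unique π-unique m∈π)

    -- Shifting values by one maps oneTo m onto oneTo (suc m) without 1, and proper vanishes on 1 and on m + 1.
    count-succProper : count (succProper ∘ shapeAt) (pairs₀ π) ≡ P
    count-succProper = begin
      count (proper ∘ suc ∘ proj₁) (pairs₀ π)  ≡⟨ count-fst (proper ∘ suc) ⟩
      count (proper ∘ suc) π                    ≡⟨ count-map proper suc π ⟨
      count proper (map suc π)                  ≡⟨ count-↭ proper (map⁺ suc (∈-𝔖⁻ {suc k} π∈𝔖)) ⟩
      count proper (map suc (oneTo m))
        ≡⟨ cong (λ b → 𝟙 b + count proper (map suc (oneTo m))) (isProper-1 [] π) ⟨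
      count proper (1 ∷ map suc (oneTo m))      ≡⟨ cong (count proper) (oneTo-suc m) ⟨
      count proper (oneTo X)                    ≡⟨ count-↭ proper (oneTo-suc-↭ m) ⟩
      count proper (X ∷ oneTo m)
        ≡⟨ cong (λ b → 𝟙 b + count proper (oneTo m)) (isProper-∉ [] π X X∉π) ⟩
      count proper (oneTo m)                    ≡⟨ count-↭ proper (∈-𝔖⁻ {suc k} π∈𝔖) ⟨
      count proper π                            ≡⟨ plrmin≡count-proper ⟨
      P                                         ∎
      where
      open ≡-Reasoning

    count-plainDescent+P : P + count (component plainDescent ∘ shapeAt) (pairs₀ π) ≡ D
    count-plainDescent+P = ℕ.suc-injective (begin
      suc (P + count (component plainDescent ∘ shapeAt) (pairs₀ π))
        ≡⟨ cong₂ (λ a b → a + b + N) count-atMax count-succProper ⟨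
      count (atMax ∘ shapeAt) (pairs₀ π) + count (succProper ∘ shapeAt) (pairs₀ π)
        + count (component plainDescent ∘ shapeAt) (pairs₀ π)
        ≡⟨ count-partition₃ _ _ _ (desc ∘ shapeAt) (pairs₀ π) partition ⟩
      count isDescent (pairs₀ π)
        ≡⟨ des-pairs₀ π m∈π π-positive ⟩
      suc D ∎)
      where
      open ≡-Reasoning
      N = count (component plainDescent ∘ shapeAt) (pairs₀ π)
      partition : ∀ {e} → e ∈ pairs₀ π → 𝟙 (atMax (shapeAt e)) + 𝟙 (succProper (shapeAt e))
                                         + 𝟙 (component plainDescent (shapeAt e)) ≡ 𝟙 (desc (shapeAt e))
      partition {e} e∈ =
        subst (λ σ → 𝟙 (atMax σ) + 𝟙 (succProper σ) + 𝟙 (component plainDescent σ) ≡ 𝟙 (desc σ))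
              (sym (shapeAt-kind e∈)) (descents-partition (kind e))

    P≤D : P ≤ D
    P≤D = subst (P ≤_) count-plainDescent+P (ℕ.m≤m+n P _)

    count-kind : ∀ k → count (is k ∘ kind) (pairs₀ π) ≡ multiplicity k (stats π)
    count-kind succession   = trans (count-component succession) (sucs-pairs₀ π)
    count-kind bigAscent    = trans (count-component bigAscent) (basc-pairs₀ π)
    count-kind maxLetter    = trans (count-component maxLetter) count-atMax
    count-kind properMin    = trans (count-component properMin) count-succProper
    count-kind plainDescent =
      trans (count-component plainDescent) (trans (sym (ℕ.m+n∸m≡n P _)) (cong (_∸ P) count-plainDescent+P))

    stats-insertAfter : ∀ {t} → t ∈ splits π → stats (insertAfter X t) ≡ shift (kind (pairAt t)) (stats π)
    stats-insertAfter {p , a , q} t∈ =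
      shift-stats (kind e) (shapeAt-kind e∈) P≤D
        (subst (λ l → 𝟙 (isBigAscent e) + basc w ≡ 𝟙 (not (a ≡ᵇ m)) + basc l) π≡
               (basc-insert m p a q a≤m h≤m))
        (subst (λ l → 𝟙 (isSucc e) + sucs w ≡ 𝟙 (a ≡ᵇ m) + sucs l) π≡ (sucs-insert m p a q h≤m))
        (subst (λ l → 𝟙 (isDescent e) + des w ≡ 1 + des l) π≡
               (des-insert m p a q a≤m h≤m (π-positive ∘ subst (_ ∈_) π≡)))
        (subst (λ l → 𝟙 (isProper [] l (suc a)) + plrmin w ≡ plrmin l) π≡
               (plrmin-insert X p a q (subst Unique (sym π≡) π-unique)
                              (subst (All _) (sym π≡) (All.tabulate (λ v∈ → π-positive v∈ , s≤s (proj₂ (π-range v∈)))))))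
      where
      e = a , next q
      w = p ++ a ∷ X ∷ q
      π≡ : p ++ a ∷ q ≡ π
      π≡ = sym (∈-splits π t∈)
      e∈ : e ∈ pairs₀ π
      e∈ = subst (e ∈_) (map-pairAt-splits π) (∈-map⁺ pairAt t∈)
      a≤m = proj₂ (π-range (fst∈π e∈))
      h≤m = snd≤m e∈

    next-π≤m : next π ≤ m
    next-π≤m = next-≤ π (proj₂ ∘ π-range)

    count-front : ∀ f → count f (pairs₀ (X ∷ π)) ≡ 𝟙 (f (X , next π)) + count f (pairs₀ π)
    count-front f = cong (count f) (pairs₀-∷ X π)

    basc-front : basc (X ∷ π) ≡ A
    basc-front = begin
      basc (X ∷ π)                                              ≡⟨ basc-pairs₀ (X ∷ π) ⟨
      count isBigAscent (pairs₀ (X ∷ π))                       ≡⟨ count-front isBigAscent ⟩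
      𝟙 (suc X <ᵇ next π) + count isBigAscent (pairs₀ π)        ≡⟨ cong₂ (λ b n → 𝟙 b + n) X≮next (basc-pairs₀ π) ⟩
      A                                                          ∎
      where
      open ≡-Reasoning
      X≮next = ≮⇒<ᵇ≡false (λ X<h → ℕ.<-asym (s≤s next-π≤m) (ℕ.<-trans (ℕ.n<1+n X) X<h))

    sucs-front : sucs (X ∷ π) ≡ C
    sucs-front = begin
      sucs (X ∷ π)                                              ≡⟨ sucs-pairs₀ (X ∷ π) ⟨
      count isSucc (pairs₀ (X ∷ π))                            ≡⟨ count-front isSucc ⟩
      𝟙 (next π ≡ᵇ suc X) + count isSucc (pairs₀ π)            ≡⟨ cong₂ (λ b n → 𝟙 b + n) next≢ (sucs-pairs₀ π) ⟩
      C                                                          ∎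
      where
      open ≡-Reasoning
      next≢ = ≢⇒≡ᵇ≡false (λ h≡ → ℕ.<-irrefl h≡ (ℕ.<-trans (s≤s next-π≤m) (ℕ.n<1+n X)))

    des-front : des (X ∷ π) ≡ suc D
    des-front = ℕ.suc-injective (begin
      suc (des (X ∷ π))                                         ≡⟨ des-pairs₀ (X ∷ π) (here refl) X∷π-positive ⟨
      count isDescent (pairs₀ (X ∷ π))                         ≡⟨ count-front isDescent ⟩
      𝟙 (next π <ᵇ X) + count isDescent (pairs₀ π)             ≡⟨ cong₂ (λ b n → 𝟙 b + n) (<⇒<ᵇ≡true (s≤s next-π≤m))
                                                                         (des-pairs₀ π m∈π π-positive) ⟩
      suc (suc D)                                                ∎)
      where
      open ≡-Reasoning
      X∷π-positive : ∀ {v} → v ∈ X ∷ π → 1 ≤ v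
      X∷π-positive (here refl) = s≤s z≤n
      X∷π-positive (there v∈)  = π-positive v∈

    plrmin-front : plrmin (X ∷ π) ≡ suc P
    plrmin-front = cong₂ (λ b n → 𝟙 b + n) m-descends
                         (plrminGo-∷ʳ-larger [] X π (All.tabulate (s≤s ∘ proj₂ ∘ π-range)))
      where
      m-descends : isProperAt [] X π ≡ true
      m-descends with ∈-map⁻ proj₁ (subst (m ∈_) (sym (map-proj₁-pairs-∷ʳ 0 π)) m∈π)
      ... | (_ , h) , e∈ , refl = Equivalence.to Bool.T-≡ (any⁺ (descendsFrom X) (lose e∈ m-descent))
        where
        m-descent : T (descendsFrom X (m , h))
        m-descent rewrite ≡ᵇ-refl m = ℕ.<⇒<ᵇ (ℕ.≤∧≢⇒< (snd≤m e∈) (fst≢snd e∈ ∘ sym))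

    stats-front : stats (X ∷ π) ≡ (A , D ∸ P , C , suc P)
    stats-front =
      cong₂ _,_ basc-front (cong₂ _,_ (cong₂ _∸_ des-front plrmin-front) (cong₂ _,_ sucs-front plrmin-front))

module Sums {c ℓ : Level} (R : CommutativeRing c ℓ) where

  open import Data.Nat as ℕ using (ℕ; suc; _≤_; s≤s)
  import Data.Nat.Properties as ℕ
  open import Data.List using (List; []; _∷_; _++_; [_]; map; concatMap; upTo)
  import Data.List.Properties as List
  open import Data.List.Membership.Propositional using (_∈_)
  open import Data.List.Relation.Unary.Any using (here; there)
  open import Data.List.Relation.Binary.Permutation.Propositional using (_↭_; prep; swap)
  import Data.List.Relation.Binary.Permutation.Propositional as ↭
  open import Data.Sum using (_⊎_; inj₁; inj₂)
  open import Function using (_∘_)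
  open import Relation.Binary.PropositionalEquality as ≡ using (_≡_)

  open CommutativeRing R
  open InRing R
  open import Relation.Binary.Reasoning.Setoid setoid
  open import Algebra.Solver.Ring.NaturalCoefficients.Default commutativeSemiring

  sumList-cong : ∀ {A : Set} {f g : A → Carrier} xs → (∀ {x} → x ∈ xs → f x ≈ g x) → sumList f xs ≈ sumList g xs
  sumList-cong []       _   = refl
  sumList-cong (x ∷ xs) f≈g = +-cong (f≈g (here ≡.refl)) (sumList-cong xs (f≈g ∘ there))

  sumList-++ : ∀ {A : Set} (f : A → Carrier) xs ys → sumList f (xs ++ ys) ≈ sumList f xs + sumList f ys
  sumList-++ f []       ys = sym (+-identityˡ _)
  sumList-++ f (x ∷ xs) ys = trans (+-congˡ (sumList-++ f xs ys)) (sym (+-assoc _ _ _))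

  sumList-concatMap : ∀ {A B : Set} (f : B → Carrier) (g : A → List B) xs →
                      sumList f (concatMap g xs) ≈ sumList (sumList f ∘ g) xs
  sumList-concatMap f g []       = refl
  sumList-concatMap f g (x ∷ xs) = trans (sumList-++ f (g x) (concatMap g xs)) (+-congˡ (sumList-concatMap f g xs))

  sumList-map : ∀ {A B : Set} (f : B → Carrier) (g : A → B) xs → sumList f (map g xs) ≡ sumList (f ∘ g) xs
  sumList-map f g []       = ≡.refl
  sumList-map f g (x ∷ xs) = ≡.cong (f (g x) +_) (sumList-map f g xs)

  sumList-↭ : ∀ {A : Set} (f : A → Carrier) {xs ys} → xs ↭ ys → sumList f xs ≈ sumList f ys
  sumList-↭ f ↭.refl          = refl
  sumList-↭ f (prep x xs↭ys)  = +-congˡ (sumList-↭ f xs↭ys)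
  sumList-↭ f (swap x y xs↭ys) =
    trans (solve 3 (λ a b s → a :+ (b :+ s) := b :+ (a :+ s)) refl (f x) (f y) _)
          (+-congˡ (+-congˡ (sumList-↭ f xs↭ys)))
  sumList-↭ f (↭.trans r₁ r₂) = trans (sumList-↭ f r₁) (sumList-↭ f r₂)

  sumList-zero : ∀ {A : Set} (f : A → Carrier) xs → (∀ x → f x ≈ 0#) → sumList f xs ≈ 0#
  sumList-zero f []       _   = refl
  sumList-zero f (x ∷ xs) f≈0 = trans (+-cong (f≈0 x) (sumList-zero f xs f≈0)) (+-identityʳ 0#)

  sumList-+ : ∀ {A : Set} (f g : A → Carrier) xs → sumList (λ x → f x + g x) xs ≈ sumList f xs + sumList g xs
  sumList-+ f g []       = sym (+-identityʳ 0#)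
  sumList-+ f g (x ∷ xs) = trans (+-congˡ (sumList-+ f g xs))
    (solve 4 (λ a b s t → (a :+ b) :+ (s :+ t) := (a :+ s) :+ (b :+ t)) refl (f x) (g x) (sumList f xs) (sumList g xs))

  sumList-*ˡ : ∀ {A : Set} a (f : A → Carrier) xs → sumList (λ x → a * f x) xs ≈ a * sumList f xs
  sumList-*ˡ a f []       = sym (zeroʳ a)
  sumList-*ˡ a f (x ∷ xs) = trans (+-congˡ (sumList-*ˡ a f xs)) (sym (distribˡ a _ _))

  sumBelow : ℕ → (ℕ → Carrier) → Carrier
  sumBelow N f = sumList f (upTo N)

  sumBelow-suc : ∀ N f → sumBelow (suc N) f ≡ f 0 + sumBelow N (f ∘ suc)
  sumBelow-suc N f = ≡.cong (f 0 +_) (≡.trans (≡.cong (sumList f) (≡.sym (List.map-upTo suc N))) (sumList-map f suc (upTo N)))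

  sumBelow-∷ʳ : ∀ N f → sumBelow (suc N) f ≈ sumBelow N f + f N
  sumBelow-∷ʳ N f = begin
    sumList f (upTo (suc N))      ≡⟨ ≡.cong (sumList f) (List.upTo-∷ʳ N) ⟨
    sumList f (upTo N ++ [ N ])   ≈⟨ sumList-++ f (upTo N) [ N ] ⟩
    sumBelow N f + (f N + 0#)     ≈⟨ +-congˡ (+-identityʳ (f N)) ⟩
    sumBelow N f + f N            ∎

  sumBelow-cong : ∀ N {f g : ℕ → Carrier} → (∀ i → f i ≈ g i) → sumBelow N f ≈ sumBelow N g
  sumBelow-cong N f≈g = sumList-cong (upTo N) (λ {i} _ → f≈g i)

  sumBelow-+ : ∀ N (f g : ℕ → Carrier) → sumBelow N (λ i → f i + g i) ≈ sumBelow N f + sumBelow N g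
  sumBelow-+ N f g = sumList-+ f g (upTo N)

  sumBelow-*ˡ : ∀ N a (f : ℕ → Carrier) → sumBelow N (λ i → a * f i) ≈ a * sumBelow N f
  sumBelow-*ˡ N a f = sumList-*ˡ a f (upTo N)

  sumBelow-zero : ∀ N (f : ℕ → Carrier) → (∀ i → f i ≈ 0#) → sumBelow N f ≈ 0#
  sumBelow-zero N f f≈0 = sumList-zero f (upTo N) f≈0

  sumBelow-head : ∀ N (f : ℕ → Carrier) → f 0 ≈ 0# → sumBelow (suc N) f ≈ sumBelow N (f ∘ suc)
  sumBelow-head N f f0≈0 = begin
    sumBelow (suc N) f            ≡⟨ sumBelow-suc N f ⟩
    f 0 + sumBelow N (f ∘ suc)    ≈⟨ +-congʳ f0≈0 ⟩
    0# + sumBelow N (f ∘ suc)     ≈⟨ +-identityˡ _ ⟩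
    sumBelow N (f ∘ suc)          ∎

  sumBelow-truncate : ∀ {M N} (f : ℕ → Carrier) → M ≤ N → (∀ i → M ≤ i → f i ≈ 0#) → sumBelow N f ≈ sumBelow M f
  sumBelow-truncate {M} {N}     f M≤N tail≈0 with ℕ.m≤n⇒m<n∨m≡n M≤N
  ... | inj₂ ≡.refl = refl
  sumBelow-truncate {M} {suc N} f M≤N tail≈0 | inj₁ (s≤s M≤N') = begin
    sumBelow (suc N) f      ≈⟨ sumBelow-∷ʳ N f ⟩
    sumBelow N f + f N      ≈⟨ +-cong (sumBelow-truncate f M≤N' tail≈0) (tail≈0 N M≤N') ⟩
    sumBelow M f + 0#       ≈⟨ +-identityʳ _ ⟩
    sumBelow M f            ∎

  ΣΣ : ℕ → ℕ → (ℕ → ℕ → Carrier) → Carrier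
  ΣΣ M N f = sumBelow M (λ i → sumBelow N (f i))

  ΣΣ-cong : ∀ M N {f g : ℕ → ℕ → Carrier} → (∀ i j → f i j ≈ g i j) → ΣΣ M N f ≈ ΣΣ M N g
  ΣΣ-cong M N f≈g = sumBelow-cong M (λ i → sumBelow-cong N (f≈g i))

  ΣΣ-+ : ∀ M N (f g : ℕ → ℕ → Carrier) → ΣΣ M N (λ i j → f i j + g i j) ≈ ΣΣ M N f + ΣΣ M N g
  ΣΣ-+ M N f g = trans (sumBelow-cong M (λ i → sumBelow-+ N (f i) (g i)))
                       (sumBelow-+ M (λ i → sumBelow N (f i)) (λ i → sumBelow N (g i)))

  ΣΣ-*ˡ : ∀ M N a (f : ℕ → ℕ → Carrier) → ΣΣ M N (λ i j → a * f i j) ≈ a * ΣΣ M N f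
  ΣΣ-*ˡ M N a f = trans (sumBelow-cong M (λ i → sumBelow-*ˡ N a (f i))) (sumBelow-*ˡ M a (λ i → sumBelow N (f i)))

  ΣΣ-headˡ : ∀ M N (f : ℕ → ℕ → Carrier) → (∀ j → f 0 j ≈ 0#) → ΣΣ (suc M) N f ≈ ΣΣ M N (f ∘ suc)
  ΣΣ-headˡ M N f f0≈0 = sumBelow-head M (λ i → sumBelow N (f i)) (sumBelow-zero N (f 0) f0≈0)

  ΣΣ-headʳ : ∀ M N (f : ℕ → ℕ → Carrier) → (∀ i → f i 0 ≈ 0#) → ΣΣ M (suc N) f ≈ ΣΣ M N (λ i j → f i (suc j))
  ΣΣ-headʳ M N f fi0≈0 = sumBelow-cong M (λ i → sumBelow-head N (f i) (fi0≈0 i))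

  ΣΣ-truncate : ∀ {M M' N N'} (f : ℕ → ℕ → Carrier) → M ≤ M' → N ≤ N' →
                (∀ i j → M ≤ i ⊎ N ≤ j → f i j ≈ 0#) → ΣΣ M' N' f ≈ ΣΣ M N f
  ΣΣ-truncate {M} {M'} {N} {N'} f M≤M' N≤N' outside≈0 = begin
    sumBelow M' (λ i → sumBelow N' (f i))
      ≈⟨ sumBelow-cong M' (λ i → sumBelow-truncate (f i) N≤N' (λ j N≤j → outside≈0 i j (inj₂ N≤j))) ⟩
    sumBelow M' (λ i → sumBelow N (f i))
      ≈⟨ sumBelow-truncate _ M≤M' (λ i M≤i → sumBelow-zero N (f i) (λ j → outside≈0 i j (inj₁ M≤i))) ⟩
    sumBelow M (λ i → sumBelow N (f i)) ∎

module Multiples {c ℓ : Level} (R : CommutativeRing c ℓ) where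

  open import Data.Nat as ℕ using (ℕ; zero; suc; _∸_)
  import Data.Nat.Properties as ℕ
  open import Relation.Binary.PropositionalEquality as ≡ using (_≡_)

  open CommutativeRing R
  open InRing R
  open import Algebra.Properties.Monoid.Mult +-monoid using (×-congʳ; ×-assocˡ)
  open import Algebra.Properties.Semiring.Mult semiring using (×-assoc-*)

  ·-zeroˡ : ∀ {k} x → k ≡ 0 → k · x ≈ 0#
  ·-zeroˡ x ≡.refl = refl

  ·-zeroʳ : ∀ k → k · 0# ≈ 0#
  ·-zeroʳ zero    = refl
  ·-zeroʳ (suc k) = trans (+-identityˡ _) (·-zeroʳ k)

  ·-*-swap : ∀ a b x → (a ℕ.* b) · x ≈ b · (a · x)
  ·-*-swap a b x = trans (reflexive (≡.cong (_· x) (ℕ.*-comm a b))) (sym (×-assocˡ x b a))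

  ·-as-* : ∀ k w → k · w ≈ (k · 1#) * w
  ·-as-* k w = sym (trans (×-assoc-* k 1# w) (×-congʳ k (*-identityˡ w)))

  ·-pow-pred : ∀ k p q r → q ≈ p * r → k · (p ^ (k ∸ 1) * q) ≈ k · (p ^ k * r)
  ·-pow-pred zero    p q r q≈pr = refl
  ·-pow-pred (suc k) p q r q≈pr =
    ×-congʳ (suc k) (trans (*-congˡ q≈pr) (trans (sym (*-assoc (p ^ k) p r)) (*-congʳ (*-comm (p ^ k) p))))

module DualNumbers where

  open import Algebra.Structures
  open import Data.Nat using (zero; suc; _∸_)
  open import Data.List using ([]; _∷_)
  open import Data.Product using (_×_; _,_; proj₁; proj₂)
  open import Function using (_∘_)
  open import Relation.Binary.PropositionalEquality as ≡ using (_≡_)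

  module _ {c ℓ : Level} (R : CommutativeRing c ℓ) where

    open CommutativeRing R
    open import Algebra.Solver.Ring.NaturalCoefficients.Default commutativeSemiring

    private
      _≈ᴰ_ : Carrier × Carrier → Carrier × Carrier → Set ℓ
      (a , a') ≈ᴰ (b , b') = (a ≈ b) × (a' ≈ b')

      _+ᴰ_ _*ᴰ_ : Carrier × Carrier → Carrier × Carrier → Carrier × Carrier
      (a , a') +ᴰ (b , b') = a + b , a' + b'
      (a , a') *ᴰ (b , b') = a * b , a * b' + a' * b

      -ᴰ_ : Carrier × Carrier → Carrier × Carrier
      -ᴰ (a , a') = - a , - a'

      +ᴰ-isAbelianGroup : IsAbelianGroup _≈ᴰ_ _+ᴰ_ (0# , 0#) -ᴰ_
      +ᴰ-isAbelianGroup = record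
        { isGroup = record
          { isMonoid = record
            { isSemigroup = record
              { isMagma = record
                { isEquivalence = record
                  { refl  = refl , refl
                  ; sym   = λ (p , q) → sym p , sym q
                  ; trans = λ (p , q) (r , s) → trans p r , trans q s }
                ; ∙-cong = λ (p , q) (r , s) → +-cong p r , +-cong q s }
              ; assoc = λ (a , a') (b , b') (d , d') → +-assoc a b d , +-assoc a' b' d' }
            ; identity = (λ (a , a') → +-identityˡ a , +-identityˡ a')
                       , (λ (a , a') → +-identityʳ a , +-identityʳ a') }
          ; inverse = (λ (a , a') → -‿inverseˡ a , -‿inverseˡ a')
                    , (λ (a , a') → -‿inverseʳ a , -‿inverseʳ a')
          ; ⁻¹-cong = λ (p , q) → -‿cong p , -‿cong q }
        ; comm = λ (a , a') (b , b') → +-comm a b , +-comm a' b' }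

    Dual : CommutativeRing c ℓ
    Dual = record
      { Carrier = Carrier × Carrier
      ; _≈_ = _≈ᴰ_ ; _+_ = _+ᴰ_ ; _*_ = _*ᴰ_ ; -_ = -ᴰ_ ; 0# = 0# , 0# ; 1# = 1# , 0#
      ; isCommutativeRing = record
        { isRing = record
          { +-isAbelianGroup = +ᴰ-isAbelianGroup
          ; *-cong = λ (p , q) (r , s) → *-cong p r , +-cong (*-cong p s) (*-cong q r)
          ; *-assoc = λ (a , a') (b , b') (d , d') → *-assoc a b d ,
              solve 6 (λ a a' b b' d d' → (a :* b) :* d' :+ (a :* b' :+ a' :* b) :* d
                                        := a :* (b :* d' :+ b' :* d) :+ a' :* (b :* d)) refl a a' b b' d d'
          ; *-identity = (λ (a , a') → *-identityˡ a , solve 2 (λ a a' → con 1 :* a' :+ con 0 :* a := a') refl a a')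
                       , (λ (a , a') → *-identityʳ a , solve 2 (λ a a' → a :* con 0 :+ a' :* con 1 := a') refl a a')
          ; distrib = (λ (a , a') (b , b') (d , d') → distribˡ a b d ,
                         solve 6 (λ a a' b b' d d' → a :* (b' :+ d') :+ a' :* (b :+ d)
                                                   := (a :* b' :+ a' :* b) :+ (a :* d' :+ a' :* d)) refl a a' b b' d d')
                    , (λ (a , a') (b , b') (d , d') → distribʳ a b d ,
                         solve 6 (λ a a' b b' d d' → (b :+ d) :* a' :+ (b' :+ d') :* a
                                                   := (b :* a' :+ b' :* a) :+ (d :* a' :+ d' :* a)) refl a a' b b' d d') }
        ; *-comm = λ (a , a') (b , b') → *-comm a b ,
            solve 4 (λ a a' b b' → a :* b' :+ a' :* b := b :* a' :+ b' :* a) refl a a' b b' } }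

  module DualProjections {c ℓ : Level} (R : CommutativeRing c ℓ) where

    open CommutativeRing R
    open InRing R
    private module D = InRing (Dual R)
    open import Relation.Binary.Reasoning.Setoid setoid
    open import Algebra.Properties.Semiring.Mult semiring using (×-comm-*)
    open import Algebra.Properties.Monoid.Mult +-monoid using (×-congʳ)

    fst-^ : ∀ (X : Carrier × Carrier) k → proj₁ (X D.^ k) ≡ proj₁ X ^ k
    fst-^ X zero    = ≡.refl
    fst-^ X (suc k) = ≡.cong (proj₁ X *_) (fst-^ X k)

    snd-^ : ∀ p w k → proj₂ ((p , w) D.^ k) ≈ k · (p ^ (k ∸ 1) * w)
    snd-^ p w zero    = refl
    snd-^ p w (suc k) = begin
      p * proj₂ ((p , w) D.^ k) + w * proj₁ ((p , w) D.^ k)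
        ≈⟨ +-cong (*-congˡ (snd-^ p w k)) (*-congˡ (reflexive (fst-^ (p , w) k))) ⟩
      p * (k · (p ^ (k ∸ 1) * w)) + w * p ^ k
        ≈⟨ +-congʳ (×-comm-* k p _) ⟩
      k · (p * (p ^ (k ∸ 1) * w)) + w * p ^ k
        ≈⟨ +-congʳ (×-congʳ k (sym (*-assoc p (p ^ (k ∸ 1)) w))) ⟩
      k · ((p * p ^ (k ∸ 1)) * w) + w * p ^ k
        ≈⟨ +-congʳ (p*p^[k∸1]*w k) ⟩
      k · (p ^ k * w) + w * p ^ k
        ≈⟨ trans (+-comm _ _) (+-congʳ (*-comm w (p ^ k))) ⟩
      suc k · (p ^ k * w) ∎
      where
      p*p^[k∸1]*w : ∀ k → k · ((p * p ^ (k ∸ 1)) * w) ≈ k · (p ^ k * w)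
      p*p^[k∸1]*w zero    = refl
      p*p^[k∸1]*w (suc k) = refl

    snd-· : ∀ k (X : Carrier × Carrier) → proj₂ (k D.· X) ≡ k · proj₂ X
    snd-· zero    X = ≡.refl
    snd-· (suc k) X = ≡.cong (proj₂ X +_) (snd-· k X)

    snd-sumList : ∀ {A : Set} (f : A → Carrier × Carrier) xs → proj₂ (D.sumList f xs) ≡ sumList (proj₂ ∘ f) xs
    snd-sumList f []       = ≡.refl
    snd-sumList f (x ∷ xs) = ≡.cong (proj₂ (f x) +_) (snd-sumList f xs)

module Gamma where

  open import Data.Nat as ℕ using (ℕ; zero; suc; _+_; _*_; _∸_; _≤_; _<_; s≤s; z≤n; ⌊_/2⌋)
  import Data.Nat.Properties as ℕ
  open import Data.Nat.Solver using (module +-*-Solver)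
  open import Data.Integer as ℤ using (ℤ; +_)
  import Data.Integer.Properties as ℤ
  import Data.Integer.Solver as ℤ-Solver
  open import Relation.Binary.PropositionalEquality
  open import Relation.Nullary using (yes; no)
  open import Data.Sum using (_⊎_; inj₁; inj₂)

  -- Each summand is named after the term of Γ (n + 1) = u Γ n + δ (Γ n) it comes from; the
  -- weight n - i - 2j + 2 is truncated at 0, which is harmless since γ vanishes where it is negative.
  mutual
    γℕ : ℕ → ℕ → ℕ → ℕ
    γℕ zero    zero    zero    = 1
    γℕ zero    zero    (suc j) = 0
    γℕ zero    (suc i) j       = 0
    γℕ (suc n) i       j       = γℕ-u n i j + γℕ-δu n i j + γℕ-δv n i j + γℕ-δz n i j

    γℕ-u : ℕ → ℕ → ℕ → ℕ
    γℕ-u n zero    j = 0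
    γℕ-u n (suc i) j = γℕ n i j

    γℕ-δu : ℕ → ℕ → ℕ → ℕ
    γℕ-δu n i zero    = 0
    γℕ-δu n i (suc j) = suc i * γℕ n (suc i) j

    γℕ-δv : ℕ → ℕ → ℕ → ℕ
    γℕ-δv n i j = j * γℕ n i j

    γℕ-δz : ℕ → ℕ → ℕ → ℕ
    γℕ-δz n i zero    = 0
    γℕ-δz n i (suc j) = (n ∸ (i + 2 * j)) * γℕ n i j

  +2*suc : ∀ i j → i + 2 * suc j ≡ suc (suc (i + 2 * j))
  +2*suc = solve 2 (λ i j → i :+ con 2 :* (con 1 :+ j) := con 2 :+ (i :+ con 2 :* j)) refl
    where
    open +-*-Solver

  n<2*suc⌊n/2⌋ : ∀ n → n < 2 ℕ.* suc ⌊ n /2⌋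
  n<2*suc⌊n/2⌋ zero          = s≤s z≤n
  n<2*suc⌊n/2⌋ (suc zero)    = s≤s (s≤s z≤n)
  n<2*suc⌊n/2⌋ (suc (suc n)) = subst (suc (suc n) <_) (sym (2*suc-suc ⌊ n /2⌋)) (s≤s (s≤s (n<2*suc⌊n/2⌋ n)))
    where
    2*suc-suc : ∀ k → 2 ℕ.* suc (suc k) ≡ suc (suc (2 ℕ.* suc k))
    2*suc-suc k = cong suc (ℕ.+-suc (suc k) (suc k ℕ.+ 0))

  γℕ-support : ∀ n i j → n < i + 2 * j → γℕ n i j ≡ 0
  γℕ-support zero    zero    zero    ()
  γℕ-support zero    zero    (suc j) _ = refl
  γℕ-support zero    (suc i) j       _ = refl
  γℕ-support (suc n) i       j       n+1< =
    sum-of-zeros (u-part i n+1<) (δu-part j n+1<)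
                 (trans (cong (j *_) (γℕ-support n i j (ℕ.<-trans (ℕ.n<1+n n) n+1<))) (ℕ.*-zeroʳ j))
                 (δz-part j n+1<)
    where
    sum-of-zeros : ∀ {a b c d} → a ≡ 0 → b ≡ 0 → c ≡ 0 → d ≡ 0 → a + b + c + d ≡ 0
    sum-of-zeros refl refl refl refl = refl
    u-part : ∀ i → suc n < i + 2 * j → γℕ-u n i j ≡ 0
    u-part zero    _        = refl
    u-part (suc i) (s≤s n<) = γℕ-support n i j n<
    δu-part : ∀ j → suc n < i + 2 * j → γℕ-δu n i j ≡ 0
    δu-part zero    _    = refl
    δu-part (suc j) n+1< =
      trans (cong (suc i *_) (γℕ-support n (suc i) j (ℕ.≤-pred (subst (suc (suc n) ≤_) (+2*suc i j) n+1<))))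
            (ℕ.*-zeroʳ (suc i))
    δz-part : ∀ j → suc n < i + 2 * j → γℕ-δz n i j ≡ 0
    δz-part zero    _    = refl
    δz-part (suc j) n+1< =
      cong (_* γℕ n i j) (ℕ.m≤n⇒m∸n≡0 (ℕ.≤-pred (ℕ.≤-pred (subst (suc (suc n) ≤_) (+2*suc i j) n+1<))))

  outside-square : ∀ n i j → suc n ≤ i ⊎ suc n ≤ j → n < i + 2 * j
  outside-square n i j (inj₁ n<i) = ℕ.≤-trans n<i (ℕ.m≤m+n i _)
  outside-square n i j (inj₂ n<j) = ℕ.≤-trans n<j (ℕ.≤-trans (ℕ.m≤m+n j (j + 0)) (ℕ.m≤n+m _ i))

  δz-coefficient : ∀ n i j → i + 2 * j ≤ n →
                   (+ n) ℤ.- (+ i) ℤ.- (+ 2) ℤ.* (+ suc j) ℤ.+ (+ 2) ≡ + (n ∸ (i + 2 * j))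
  δz-coefficient n i j i+2j≤n = begin
    (+ n) ℤ.- (+ i) ℤ.- (+ 2) ℤ.* (+ suc j) ℤ.+ (+ 2)   ≡⟨ regroup (+ n) (+ i) (+ j) ⟩
    (+ n) ℤ.- ((+ i) ℤ.+ (+ 2) ℤ.* (+ j))                ≡⟨ cong (λ k → (+ n) ℤ.- ((+ i) ℤ.+ k)) (ℤ.pos-* 2 j) ⟨
    (+ n) ℤ.- (+ (i + 2 * j))                            ≡⟨ ℤ.m-n≡m⊖n n (i + 2 * j) ⟩
    n ℤ.⊖ (i + 2 * j)                                    ≡⟨ ℤ.⊖-≥ i+2j≤n ⟩
    + (n ∸ (i + 2 * j))                                  ∎
    where
    open ≡-Reasoning
    open ℤ-Solver.+-*-Solver
    regroup : ∀ N I J → N ℤ.- I ℤ.- (+ 2) ℤ.* ((+ 1) ℤ.+ J) ℤ.+ (+ 2) ≡ N ℤ.- (I ℤ.+ (+ 2) ℤ.* J)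
    regroup = solve 3 (λ N I J → N :- I :- con (+ 2) :* (con (+ 1) :+ J) :+ con (+ 2) := N :- (I :+ con (+ 2) :* J)) refl

  module InductionStep (n : ℕ) (IH : ∀ i j → γ n i j ≡ + γℕ n i j) where

    +-hom₄ : ∀ {a b c d} a' b' c' d' → a ≡ + a' → b ≡ + b' → c ≡ + c' → d ≡ + d' →
             a ℤ.+ b ℤ.+ c ℤ.+ d ≡ + (a' + b' + c' + d')
    +-hom₄ a' b' c' d' refl refl refl refl =
      sym (trans (ℤ.pos-+ (a' + b' + c') d')
                 (cong (ℤ._+ + d') (trans (ℤ.pos-+ (a' + b') c') (cong (ℤ._+ + c') (ℤ.pos-+ a' b')))))

    scaled : ∀ k i j → (+ k) ℤ.* γ n i j ≡ + (k * γℕ n i j)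
    scaled k i j = trans (cong ((+ k) ℤ.*_) (IH i j)) (sym (ℤ.pos-* k (γℕ n i j)))

    δz-part : ∀ i j → ((+ n) ℤ.- (+ i) ℤ.- (+ 2) ℤ.* (+ suc j) ℤ.+ (+ 2)) ℤ.* γ n i j ≡ + γℕ-δz n i (suc j)
    δz-part i j with i + 2 * j ℕ.≤? n
    ... | yes i+2j≤n = trans (cong (ℤ._* γ n i j) (δz-coefficient n i j i+2j≤n)) (scaled (n ∸ (i + 2 * j)) i j)
    ... | no  i+2j≰n rewrite IH i j | γℕ-support n i j (ℕ.≰⇒> i+2j≰n) =
      trans (ℤ.*-zeroʳ ((+ n) ℤ.- (+ i) ℤ.- (+ 2) ℤ.* (+ suc j) ℤ.+ (+ 2)))
            (cong +_ (sym (ℕ.*-zeroʳ (n ∸ (i + 2 * j)))))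

    parts : ∀ i j {a b c d} → a ≡ + γℕ-u n i j → b ≡ + γℕ-δu n i j → c ≡ + γℕ-δv n i j → d ≡ + γℕ-δz n i j →
            a ℤ.+ b ℤ.+ c ℤ.+ d ≡ + γℕ (suc n) i j
    parts i j = +-hom₄ (γℕ-u n i j) (γℕ-δu n i j) (γℕ-δv n i j) (γℕ-δz n i j)

    γ-suc : ∀ i j → γ (suc n) i j ≡ + γℕ (suc n) i j
    γ-suc zero    zero    = parts zero zero refl refl (scaled 0 0 0) refl
    γ-suc zero    (suc j) = parts zero (suc j) refl (scaled 1 1 j) (scaled (suc j) 0 (suc j)) (δz-part 0 j)
    γ-suc (suc i) zero    = parts (suc i) zero (IH i 0) refl (scaled 0 (suc i) 0) refl
    γ-suc (suc i) (suc j) =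
      parts (suc i) (suc j) (IH i (suc j)) (scaled (suc (suc i)) (suc (suc i)) j) (scaled (suc j) (suc i) (suc j))
            (δz-part (suc i) j)

  γ≡γℕ : ∀ n i j → γ n i j ≡ + γℕ n i j
  γ≡γℕ zero    zero    zero    = refl
  γ≡γℕ zero    zero    (suc j) = refl
  γ≡γℕ zero    (suc i) j       = refl
  γ≡γℕ (suc n) i       j       = InductionStep.γ-suc n (γ≡γℕ n) i j

module GammaPolynomial {c ℓ : Level} (R : CommutativeRing c ℓ) (u v z : CommutativeRing.Carrier R) where

  open Gamma
  open import Data.Nat as ℕ using (ℕ; suc; _∸_; _≤_; _<_; s≤s; ⌊_/2⌋)
  import Data.Nat.Properties as ℕ
  open import Data.Sum using (_⊎_; inj₁; inj₂)
  open import Function using (_∘_)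
  open import Relation.Binary.PropositionalEquality as ≡ using (_≡_)
  open import Relation.Nullary using (yes; no)

  open CommutativeRing R
  open InRing R
  open Sums R
  open Multiples R
  open import Relation.Binary.Reasoning.Setoid setoid
  open import Algebra.Properties.Monoid.Mult +-monoid using (×-homo-+; ×-congʳ)
  open import Algebra.Properties.Semiring.Mult semiring using (×-comm-*; ×-assoc-*)
  open import Algebra.Properties.CommutativeMonoid.Mult +-commutativeMonoid using (×-distrib-+)

  zExp : ℕ → ℕ → ℕ → ℕ
  zExp n i j = n ∸ (i ℕ.+ 2 ℕ.* j)

  term : ℕ → ℕ → ℕ → Carrier
  term n i j = u ^ i * v ^ j * z ^ zExp n i j

  Γ : ℕ → Carrier
  Γ n = ΣΣ (suc n) (suc n) (λ i j → γℕ n i j · term n i j)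

  -- δu-term + δv-term + δz-term is δ (term n i j) for the derivation δ with δu = v, δv = v z, δz = v.
  δu-term δv-term δz-term : ℕ → ℕ → ℕ → Carrier
  δu-term n i j = i · (u ^ (i ∸ 1) * v ^ suc j * z ^ zExp n i j)
  δv-term n i j = j · (u ^ i * v ^ j * z ^ suc (zExp n i j))
  δz-term n i j = zExp n i j · (u ^ i * v ^ suc j * z ^ (zExp n i j ∸ 1))

  δΓ : ℕ → Carrier
  δΓ n = ΣΣ (suc n) (suc n) (λ i j → γℕ n i j · (δu-term n i j + δv-term n i j + δz-term n i j))

  γℕ·-vanishes : ∀ {n i j} → n < i ℕ.+ 2 ℕ.* j → ∀ x → γℕ n i j · x ≈ 0#
  γℕ·-vanishes {n} {i} {j} n<i+2j x = ·-zeroˡ x (γℕ-support n i j n<i+2j)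

  zExp-δu : ∀ n i j → zExp (suc n) i (suc j) ≡ zExp n (suc i) j
  zExp-δu n i j = ≡.cong (suc n ∸_) (+2*suc i j)

  zExp-δz : ∀ n i j → zExp (suc n) i (suc j) ≡ zExp n i j ∸ 1
  zExp-δz n i j = ≡.trans (zExp-δu n i j)
    (≡.trans (≡.cong (n ∸_) (ℕ.+-comm 1 (i ℕ.+ 2 ℕ.* j))) (≡.sym (ℕ.∸-+-assoc n (i ℕ.+ 2 ℕ.* j) 1)))

  term-cong : ∀ i j {e e'} → e ≡ e' → u ^ i * v ^ j * z ^ e ≈ u ^ i * v ^ j * z ^ e'
  term-cong i j ≡.refl = refl

  sum-γℕ-u : ∀ n → ΣΣ (suc (suc n)) (suc (suc n)) (λ i j → γℕ-u n i j · term (suc n) i j) ≈ u * Γ n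
  sum-γℕ-u n = begin
    ΣΣ (suc (suc n)) (suc (suc n)) (λ i j → γℕ-u n i j · term (suc n) i j)
      ≈⟨ ΣΣ-headˡ (suc n) (suc (suc n)) _ (λ _ → refl) ⟩
    ΣΣ (suc n) (suc (suc n)) (λ i j → γℕ n i j · term (suc n) (suc i) j)
      ≈⟨ ΣΣ-cong (suc n) (suc (suc n)) (λ i j →
           trans (×-congʳ (γℕ n i j) (u-factor i j)) (sym (×-comm-* (γℕ n i j) u _))) ⟩
    ΣΣ (suc n) (suc (suc n)) (λ i j → u * (γℕ n i j · term n i j))
      ≈⟨ ΣΣ-*ˡ (suc n) (suc (suc n)) u _ ⟩
    u * ΣΣ (suc n) (suc (suc n)) (λ i j → γℕ n i j · term n i j)
      ≈⟨ *-congˡ (ΣΣ-truncate (λ i j → γℕ n i j · term n i j) ℕ.≤-refl (ℕ.n≤1+n _)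
                               (λ i j out → γℕ·-vanishes (outside-square n i j out) _)) ⟩
    u * Γ n ∎
    where
    open import Algebra.Solver.Ring.NaturalCoefficients.Default commutativeSemiring
    u-factor : ∀ i j → term (suc n) (suc i) j ≈ u * term n i j
    u-factor i j = solve 4 (λ a b c d → a :* b :* c :* d := a :* (b :* c :* d)) refl u (u ^ i) (v ^ j) (z ^ zExp n i j)

  sum-γℕ-δu : ∀ n → ΣΣ (suc (suc n)) (suc (suc n)) (λ i j → γℕ-δu n i j · term (suc n) i j)
                  ≈ ΣΣ (suc n) (suc n) (λ i j → γℕ n i j · δu-term n i j)
  sum-γℕ-δu n = begin
    ΣΣ (suc (suc n)) (suc (suc n)) (λ i j → γℕ-δu n i j · term (suc n) i j)
      ≈⟨ ΣΣ-headʳ (suc (suc n)) (suc n) _ (λ _ → refl) ⟩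
    ΣΣ (suc (suc n)) (suc n) (λ i j → (suc i ℕ.* γℕ n (suc i) j) · term (suc n) i (suc j))
      ≈⟨ ΣΣ-cong (suc (suc n)) (suc n) (λ i j →
           trans (×-congʳ (suc i ℕ.* γℕ n (suc i) j) (term-cong i (suc j) (zExp-δu n i j)))
                 (·-*-swap (suc i) (γℕ n (suc i) j) _)) ⟩
    ΣΣ (suc (suc n)) (suc n) (λ i j → γℕ n (suc i) j · δu-term n (suc i) j)
      ≈⟨ ΣΣ-truncate (λ i j → γℕ n (suc i) j · δu-term n (suc i) j)
                     (ℕ.≤-trans (ℕ.n≤1+n n) (ℕ.n≤1+n (suc n))) ℕ.≤-refl vanishes ⟩
    ΣΣ n (suc n) (λ i j → γℕ n (suc i) j · δu-term n (suc i) j)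
      ≈⟨ ΣΣ-headˡ n (suc n) (λ i j → γℕ n i j · δu-term n i j) (λ j → ·-zeroʳ (γℕ n 0 j)) ⟨
    ΣΣ (suc n) (suc n) (λ i j → γℕ n i j · δu-term n i j) ∎
    where
    vanishes : ∀ i j → n ≤ i ⊎ suc n ≤ j → γℕ n (suc i) j · δu-term n (suc i) j ≈ 0#
    vanishes i j (inj₁ n≤i) = γℕ·-vanishes (s≤s (ℕ.≤-trans n≤i (ℕ.m≤m+n i _))) _
    vanishes i j (inj₂ n<j) = γℕ·-vanishes (ℕ.<-trans (outside-square n i j (inj₂ n<j)) (ℕ.n<1+n _)) _

  sum-γℕ-δv : ∀ n → ΣΣ (suc (suc n)) (suc (suc n)) (λ i j → γℕ-δv n i j · term (suc n) i j)
                  ≈ ΣΣ (suc n) (suc n) (λ i j → γℕ n i j · δv-term n i j)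
  sum-γℕ-δv n = begin
    ΣΣ (suc (suc n)) (suc (suc n)) (λ i j → γℕ-δv n i j · term (suc n) i j)
      ≈⟨ ΣΣ-cong (suc (suc n)) (suc (suc n)) pointwise ⟩
    ΣΣ (suc (suc n)) (suc (suc n)) (λ i j → γℕ n i j · δv-term n i j)
      ≈⟨ ΣΣ-truncate (λ i j → γℕ n i j · δv-term n i j) (ℕ.n≤1+n _) (ℕ.n≤1+n _)
                     (λ i j out → γℕ·-vanishes (outside-square n i j out) _) ⟩
    ΣΣ (suc n) (suc n) (λ i j → γℕ n i j · δv-term n i j) ∎
    where
    pointwise : ∀ i j → (j ℕ.* γℕ n i j) · term (suc n) i j ≈ γℕ n i j · δv-term n i j
    pointwise i j with i ℕ.+ 2 ℕ.* j ℕ.≤? n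
    ... | yes i+2j≤n =
      trans (×-congʳ (j ℕ.* γℕ n i j) (term-cong i j (ℕ.+-∸-assoc 1 i+2j≤n))) (·-*-swap j (γℕ n i j) _)
    ... | no  i+2j≰n = trans (·-zeroˡ _ (≡.trans (≡.cong (j ℕ.*_) γℕ≡0) (ℕ.*-zeroʳ j)))
                             (sym (·-zeroˡ _ γℕ≡0))
      where γℕ≡0 = γℕ-support n i j (ℕ.≰⇒> i+2j≰n)

  sum-γℕ-δz : ∀ n → ΣΣ (suc (suc n)) (suc (suc n)) (λ i j → γℕ-δz n i j · term (suc n) i j)
                  ≈ ΣΣ (suc n) (suc n) (λ i j → γℕ n i j · δz-term n i j)
  sum-γℕ-δz n = begin
    ΣΣ (suc (suc n)) (suc (suc n)) (λ i j → γℕ-δz n i j · term (suc n) i j)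
      ≈⟨ ΣΣ-headʳ (suc (suc n)) (suc n) _ (λ _ → refl) ⟩
    ΣΣ (suc (suc n)) (suc n) (λ i j → (zExp n i j ℕ.* γℕ n i j) · term (suc n) i (suc j))
      ≈⟨ ΣΣ-cong (suc (suc n)) (suc n) (λ i j →
           trans (×-congʳ (zExp n i j ℕ.* γℕ n i j) (term-cong i (suc j) (zExp-δz n i j)))
                 (·-*-swap (zExp n i j) (γℕ n i j) _)) ⟩
    ΣΣ (suc (suc n)) (suc n) (λ i j → γℕ n i j · δz-term n i j)
      ≈⟨ ΣΣ-truncate (λ i j → γℕ n i j · δz-term n i j) (ℕ.n≤1+n _) ℕ.≤-refl
                     (λ i j out → γℕ·-vanishes (outside-square n i j out) _) ⟩
    ΣΣ (suc n) (suc n) (λ i j → γℕ n i j · δz-term n i j) ∎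

  Γ-suc : ∀ n → Γ (suc n) ≈ u * Γ n + δΓ n
  Γ-suc n = begin
    Γ (suc n)
      ≈⟨ ΣΣ-cong N N (λ i j →
           split (γℕ-u n i j) (γℕ-δu n i j) (γℕ-δv n i j) (γℕ-δz n i j) (term (suc n) i j)) ⟩
    ΣΣ N N (λ i j → γℕ-u n i j · term (suc n) i j + γℕ-δu n i j · term (suc n) i j
                   + γℕ-δv n i j · term (suc n) i j + γℕ-δz n i j · term (suc n) i j)
      ≈⟨ trans (ΣΣ-+ N N _ _) (+-congʳ (trans (ΣΣ-+ N N _ _) (+-congʳ (ΣΣ-+ N N _ _)))) ⟩
    _ + _ + _ + _
      ≈⟨ +-cong (+-cong (+-cong (sum-γℕ-u n) (sum-γℕ-δu n)) (sum-γℕ-δv n)) (sum-γℕ-δz n) ⟩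
    u * Γ n + ΣΣ N' N' (λ i j → γℕ n i j · δu-term n i j) + ΣΣ N' N' (λ i j → γℕ n i j · δv-term n i j)
            + ΣΣ N' N' (λ i j → γℕ n i j · δz-term n i j)
      ≈⟨ trans (+-assoc _ _ _) (trans (+-assoc _ _ _) (+-congˡ (sym (+-assoc _ _ _)))) ⟩
    u * Γ n + (ΣΣ N' N' (λ i j → γℕ n i j · δu-term n i j) + ΣΣ N' N' (λ i j → γℕ n i j · δv-term n i j)
            + ΣΣ N' N' (λ i j → γℕ n i j · δz-term n i j))
      ≈⟨ +-congˡ (sym δΓ-split) ⟩
    u * Γ n + δΓ n ∎
    where
    N  = suc (suc n)
    N' = suc n
    split : ∀ a b c d x → (a ℕ.+ b ℕ.+ c ℕ.+ d) · x ≈ a · x + b · x + c · x + d · x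
    split a b c d x =
      trans (×-homo-+ x (a ℕ.+ b ℕ.+ c) d) (+-congʳ (trans (×-homo-+ x (a ℕ.+ b) c) (+-congʳ (×-homo-+ x a b))))
    δΓ-split : δΓ n ≈ ΣΣ N' N' (λ i j → γℕ n i j · δu-term n i j) + ΣΣ N' N' (λ i j → γℕ n i j · δv-term n i j)
                      + ΣΣ N' N' (λ i j → γℕ n i j · δz-term n i j)
    δΓ-split =
      trans (ΣΣ-cong N' N' (λ i j → trans (×-distrib-+ _ _ (γℕ n i j)) (+-congʳ (×-distrib-+ _ _ (γℕ n i j)))))
            (trans (ΣΣ-+ N' N' _ _) (+-congʳ (ΣΣ-+ N' N' _ _)))

  Γ-u≈0 : u ≈ 0# → ∀ n → Γ n ≈ sumTo ⌊ n /2⌋ (λ j → fromℤ (γ n 0 j) * v ^ j * z ^ (n ∸ 2 ℕ.* j))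
  Γ-u≈0 u≈0 n = begin
    Γ n
      ≡⟨ sumBelow-suc n row ⟩
    row 0 + sumBelow n (row ∘ suc)
      ≈⟨ +-congˡ (sumBelow-zero n (row ∘ suc) (λ i → sumBelow-zero (suc n) _ (λ j → u-row≈0 i j))) ⟩
    row 0 + 0#
      ≈⟨ +-identityʳ _ ⟩
    row 0
      ≈⟨ sumBelow-truncate (λ j → γℕ n 0 j · term n 0 j) (s≤s (ℕ.⌊n/2⌋≤n n))
           (λ j ⌊n/2⌋<j → γℕ·-vanishes (ℕ.<-≤-trans (n<2*suc⌊n/2⌋ n) (ℕ.*-monoʳ-≤ 2 ⌊n/2⌋<j)) _) ⟩
    sumBelow (suc ⌊ n /2⌋) (λ j → γℕ n 0 j · term n 0 j)
      ≈⟨ sumBelow-cong (suc ⌊ n /2⌋) (λ j → sym (fromℤ-γ j)) ⟩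
    sumTo ⌊ n /2⌋ (λ j → fromℤ (γ n 0 j) * v ^ j * z ^ (n ∸ 2 ℕ.* j)) ∎
    where
    row : ℕ → Carrier
    row i = sumBelow (suc n) (λ j → γℕ n i j · term n i j)
    u-row≈0 : ∀ i j → γℕ n (suc i) j · term n (suc i) j ≈ 0#
    u-row≈0 i j =
      trans (×-congʳ (γℕ n (suc i) j) (trans (*-congʳ (trans (*-congʳ (trans (*-congʳ u≈0) (zeroˡ _))) (zeroˡ _)))
                                             (zeroˡ _)))
            (·-zeroʳ (γℕ n (suc i) j))
    fromℤ-γ : ∀ j → fromℤ (γ n 0 j) * v ^ j * z ^ (n ∸ 2 ℕ.* j) ≈ γℕ n 0 j · term n 0 j
    fromℤ-γ j = begin
      fromℤ (γ n 0 j) * v ^ j * z ^ (n ∸ 2 ℕ.* j)      ≡⟨ ≡.cong (λ k → fromℤ k * v ^ j * z ^ (n ∸ 2 ℕ.* j)) (γ≡γℕ n 0 j) ⟩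
      (γℕ n 0 j · 1#) * v ^ j * z ^ (n ∸ 2 ℕ.* j)      ≈⟨ *-congʳ (×-assoc-* (γℕ n 0 j) 1# (v ^ j)) ⟩
      (γℕ n 0 j · (1# * v ^ j)) * z ^ (n ∸ 2 ℕ.* j)    ≈⟨ ×-assoc-* (γℕ n 0 j) (1# * v ^ j) _ ⟩
      γℕ n 0 j · term n 0 j                             ∎

module GeneratingFunction where

  open Permutations
  open Statistics
  open DualNumbers
  open Gamma
  open import Data.Nat using (ℕ; zero; suc; _∸_)
  open import Data.List using (List; []; _∷_; map; concatMap; upTo)
  open import Data.List.Membership.Propositional using (_∈_)
  open import Data.Product using (_×_; _,_; proj₂)
  open import Function using (_∘_)
  open import Relation.Binary.PropositionalEquality as ≡ using (_≡_)

  module Weights {c ℓ : Level} (R : CommutativeRing c ℓ) (x y s t : CommutativeRing.Carrier R) where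

    open CommutativeRing R
    open InRing R
    open Sums R
    open import Relation.Binary.Reasoning.Setoid setoid
    open import Algebra.Properties.Monoid.Mult +-monoid using (×-homo-+)
    open import Algebra.Solver.Ring.NaturalCoefficients.Default commutativeSemiring

    mono : Stats → Carrier
    mono (A , B , C , P) = x ^ A * y ^ B * s ^ C * t ^ P

    -- x y (∂x + ∂y + ∂s + ∂t) applied to the monomial x^A y^B s^C t^P.
    δmono : Stats → Carrier
    δmono E@(A , B , C , P) =
      A · mono (shift bigAscent E) + B · mono (shift plainDescent E)
      + C · mono (shift succession E) + P · mono (shift properMin E)

    weight : List ℕ → Carrier
    weight = mono ∘ stats

    L : ℕ → Carrier
    L n = sumList weight (𝔖 (suc n))

    Γ : ℕ → Carrier
    Γ = GammaPolynomial.Γ R (s + t) ((2 · 1#) * x * y) (x + y)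

    kinds : List Kind
    kinds = succession ∷ bigAscent ∷ maxLetter ∷ properMin ∷ plainDescent ∷ []

    sumList-indicator : ∀ (g : Kind → Carrier) k' → sumList (λ k → 𝟙 (is k k') · g k) kinds ≈ g k'
    sumList-indicator g succession   =
      solve 1 (λ a → (a :+ con 0) :+ (con 0 :+ (con 0 :+ (con 0 :+ (con 0 :+ con 0)))) := a) refl (g succession)
    sumList-indicator g bigAscent    =
      solve 1 (λ a → con 0 :+ ((a :+ con 0) :+ (con 0 :+ (con 0 :+ (con 0 :+ con 0)))) := a) refl (g bigAscent)
    sumList-indicator g maxLetter    =
      solve 1 (λ a → con 0 :+ (con 0 :+ ((a :+ con 0) :+ (con 0 :+ (con 0 :+ con 0)))) := a) refl (g maxLetter)
    sumList-indicator g properMin    =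
      solve 1 (λ a → con 0 :+ (con 0 :+ (con 0 :+ ((a :+ con 0) :+ (con 0 :+ con 0)))) := a) refl (g properMin)
    sumList-indicator g plainDescent =
      solve 1 (λ a → con 0 :+ (con 0 :+ (con 0 :+ (con 0 :+ ((a :+ con 0) :+ con 0)))) := a) refl (g plainDescent)

    sumList-byKind : ∀ {A : Set} (κ : A → Kind) (g : Kind → Carrier) xs →
                     sumList (g ∘ κ) xs ≈ sumList (λ k → count (is k ∘ κ) xs · g k) kinds
    sumList-byKind κ g []       = sym (sumList-zero _ kinds (λ _ → refl))
    sumList-byKind κ g (e ∷ xs) = begin
      g (κ e) + sumList (g ∘ κ) xs
        ≈⟨ +-cong (sym (sumList-indicator g (κ e))) (sumList-byKind κ g xs) ⟩
      sumList (λ k → 𝟙 (is k (κ e)) · g k) kinds + sumList (λ k → count (is k ∘ κ) xs · g k) kinds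
        ≈⟨ sumList-+ (λ k → 𝟙 (is k (κ e)) · g k) (λ k → count (is k ∘ κ) xs · g k) kinds ⟨
      sumList (λ k → 𝟙 (is k (κ e)) · g k + count (is k ∘ κ) xs · g k) kinds
        ≈⟨ sumList-cong kinds (λ {k} _ → sym (×-homo-+ (g k) (𝟙 (is k (κ e))) (count (is k ∘ κ) xs))) ⟩
      sumList (λ k → count (is k ∘ κ) (e ∷ xs) · g k) kinds ∎

    sum-insertions : ∀ {k π} → π ∈ 𝔖 (suc k) →
                     sumList weight (insertions (suc (suc k)) π) ≈ (s + t) * weight π + δmono (stats π)
    sum-insertions {k} {π} π∈ = begin
      sumList weight (insertions X π)
        ≡⟨ ≡.cong (sumList weight) (insertions-splits X π) ⟩
      weight (X ∷ π) + sumList weight (map (insertAfter X) (splits π))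
        ≡⟨ ≡.cong₂ _+_ (≡.cong mono stats-front) (sumList-map weight (insertAfter X) (splits π)) ⟩
      front + sumList (weight ∘ insertAfter X) (splits π)
        ≈⟨ +-congˡ (sumList-cong (splits π) (λ τ∈ → reflexive (≡.cong mono (stats-insertAfter τ∈)))) ⟩
      front + sumList (g ∘ kind ∘ pairAt) (splits π)
        ≡⟨ ≡.cong (front +_) (≡.trans (≡.sym (sumList-map (g ∘ kind) pairAt (splits π)))
                                      (≡.cong (sumList (g ∘ kind)) (map-pairAt-splits π))) ⟩
      front + sumList (g ∘ kind) (pairs₀ π)
        ≈⟨ +-congˡ (sumList-byKind kind g (pairs₀ π)) ⟩
      front + sumList (λ k → count (is k ∘ kind) (pairs₀ π) · g k) kinds
        ≈⟨ +-congˡ (sumList-cong kinds (λ {k} _ → reflexive (≡.cong (_· g k) (count-kind k)))) ⟩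
      front + sumList (λ k → multiplicity k E · g k) kinds
        ≈⟨ solve 10 (λ xA yB sC tP s t c₁ a₂ p₄ b₅ →
                       xA :* yB :* sC :* (t :* tP)
                         :+ (c₁ :+ (a₂ :+ ((xA :* yB :* (s :* sC) :* tP :+ con 0) :+ (p₄ :+ (b₅ :+ con 0)))))
                    := (s :+ t) :* (xA :* yB :* sC :* tP) :+ (a₂ :+ b₅ :+ c₁ :+ p₄))
                   refl (x ^ A) (y ^ B) (s ^ C) (t ^ P) s t
                   (C · g succession) (A · g bigAscent) (P · g properMin) (B · g plainDescent) ⟩
      (s + t) * weight π + δmono E ∎
      where
      open Insertion {k} {π} π∈
      E = stats π
      B = D ∸ P
      front = mono (A , B , C , suc P)
      g : Kind → Carrier
      g k = mono (shift k E)

  module Derivative {c ℓ : Level} (R : CommutativeRing c ℓ) (x y s t : CommutativeRing.Carrier R) where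

    open CommutativeRing R
    open InRing R
    open Sums R
    open DualProjections R
    open Multiples R
    open import Relation.Binary.Reasoning.Setoid setoid
    open import Algebra.Properties.Monoid.Mult +-monoid using (×-congʳ)
    open import Algebra.Solver.Ring.NaturalCoefficients.Default commutativeSemiring
    private
      module D  = CommutativeRing (Dual R)
      module Dᴿ = InRing (Dual R)
      module W  = Weights R x y s t

    -- Evaluating at the dual numbers a + (x y) ε computes x y (∂x + ∂y + ∂s + ∂t) in the ε-part.
    Xᴰ Yᴰ Sᴰ Tᴰ : Carrier × Carrier
    Xᴰ = x , x * y
    Yᴰ = y , x * y
    Sᴰ = s , x * y
    Tᴰ = t , x * y

    private module Wᴰ = Weights (Dual R) Xᴰ Yᴰ Sᴰ Tᴰ

    snd-mono : ∀ E → proj₂ (Wᴰ.mono E) ≈ W.δmono E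
    snd-mono (a , b , c' , d) = begin
      proj₂ (Wᴰ.mono (a , b , c' , d))
        ≈⟨ +-cong (*-cong (reflexive (≡.cong₂ _*_ (≡.cong₂ _*_ (fst-^ Xᴰ a) (fst-^ Yᴰ b)) (fst-^ Sᴰ c'))) dD)
                  (*-cong (+-cong (*-cong (reflexive (≡.cong₂ _*_ (fst-^ Xᴰ a) (fst-^ Yᴰ b))) dC)
                                  (*-cong (+-cong (*-cong (reflexive (fst-^ Xᴰ a)) dB) (*-cong dA (reflexive (fst-^ Yᴰ b))))
                                          (reflexive (fst-^ Sᴰ c'))))
                          (reflexive (fst-^ Tᴰ d))) ⟩
      ((xa * yb) * sc) * (Kd * (td1 * (x * y))) + ((xa * yb) * (Kc * (sc1 * (x * y)))
        + (xa * (Kb * (yb * x)) + (Ka * (xa * y)) * yb) * sc) * td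
        ≈⟨ solve 12 (λ xa yb sc td x y sc1 td1 Ka Kb Kc Kd →
             ((xa :* yb) :* sc) :* (Kd :* (td1 :* (x :* y))) :+ ((xa :* yb) :* (Kc :* (sc1 :* (x :* y)))
               :+ (xa :* (Kb :* (yb :* x)) :+ (Ka :* (xa :* y)) :* yb) :* sc) :* td
             := Ka :* (xa :* (y :* yb) :* sc :* td) :+ Kb :* ((x :* xa) :* yb :* sc :* td)
                :+ Kc :* ((x :* xa) :* (y :* yb) :* sc1 :* td) :+ Kd :* ((x :* xa) :* (y :* yb) :* sc :* td1))
             refl xa yb sc td x y sc1 td1 Ka Kb Kc Kd ⟩
      Ka * (xa * (y * yb) * sc * td) + Kb * ((x * xa) * yb * sc * td)
        + Kc * ((x * xa) * (y * yb) * sc1 * td) + Kd * ((x * xa) * (y * yb) * sc * td1)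
        ≈⟨ +-cong (+-cong (+-cong (·-as-* a _) (·-as-* b _)) (·-as-* c' _)) (·-as-* d _) ⟨
      W.δmono (a , b , c' , d) ∎
      where
      xa = x ^ a ; yb = y ^ b ; sc = s ^ c' ; td = t ^ d
      sc1 = s ^ (c' ∸ 1) ; td1 = t ^ (d ∸ 1)
      Ka = a · 1# ; Kb = b · 1# ; Kc = c' · 1# ; Kd = d · 1#
      dA : proj₂ (Xᴰ Dᴿ.^ a) ≈ Ka * (xa * y)
      dA = trans (snd-^ x (x * y) a) (trans (·-pow-pred a x (x * y) y refl) (·-as-* a _))
      dB : proj₂ (Yᴰ Dᴿ.^ b) ≈ Kb * (yb * x)
      dB = trans (snd-^ y (x * y) b) (trans (·-pow-pred b y (x * y) x (*-comm x y)) (·-as-* b _))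
      dC : proj₂ (Sᴰ Dᴿ.^ c') ≈ Kc * (sc1 * (x * y))
      dC = trans (snd-^ s (x * y) c') (·-as-* c' _)
      dD : proj₂ (Tᴰ Dᴿ.^ d) ≈ Kd * (td1 * (x * y))
      dD = trans (snd-^ t (x * y) d) (·-as-* d _)

    snd-weights : ∀ l → proj₂ (Dᴿ.sumList Wᴰ.weight l) ≈ sumList (W.δmono ∘ stats) l
    snd-weights l = trans (reflexive (snd-sumList Wᴰ.weight l)) (sumList-cong l (λ {π} _ → snd-mono (stats π)))

    u v z : Carrier
    u = s + t
    v = (2 · 1#) * x * y
    z = x + y

    Uᴰ Vᴰ Zᴰ : Carrier × Carrier
    Uᴰ = Sᴰ D.+ Tᴰ
    Vᴰ = (2 Dᴿ.· D.1#) D.* Xᴰ D.* Yᴰ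
    Zᴰ = Xᴰ D.+ Yᴰ

    private
      module Γ  = GammaPolynomial R u v z
      module Γᴰ = GammaPolynomial (Dual R) Uᴰ Vᴰ Zᴰ

    -- 2 · 1# unfolds to 1# + (1# + 0#), whereas con 2 would denote 1# + 1#.
    two : ∀ {k} → Polynomial k
    two = con 1 :+ (con 1 :+ con 0)

    snd-Uᴰ : proj₂ Uᴰ ≈ v
    snd-Uᴰ = solve 2 (λ x y → x :* y :+ x :* y := two :* x :* y) refl x y

    snd-Vᴰ : proj₂ Vᴰ ≈ v * z
    snd-Vᴰ = solve 2 (λ x y → two :* x :* (x :* y) :+ (two :* (x :* y) :+ (con 0 :+ (con 0 :+ con 0)) :* x) :* y
                           := two :* x :* y :* (x :+ y)) refl x y

    snd-term : ∀ n i j → proj₂ (Γᴰ.term n i j) ≈ Γ.δu-term n i j + Γ.δv-term n i j + Γ.δz-term n i j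
    snd-term n i j = begin
      proj₂ (Γᴰ.term n i j)
        ≈⟨ +-cong (*-cong (reflexive (≡.cong₂ _*_ (fst-^ Uᴰ i) (fst-^ Vᴰ j))) dZ)
                  (*-cong (+-cong (*-cong (reflexive (fst-^ Uᴰ i)) dV) (*-cong dU (reflexive (fst-^ Vᴰ j))))
                          (reflexive (fst-^ Zᴰ e))) ⟩
      (ui * vj) * (Ke * (ze1 * v)) + (ui * (Kj * (vj * z)) + (Ki * (ui1 * v)) * vj) * ze
        ≈⟨ solve 10 (λ ui vj ze ui1 ze1 v z Ki Kj Ke →
             (ui :* vj) :* (Ke :* (ze1 :* v)) :+ (ui :* (Kj :* (vj :* z)) :+ (Ki :* (ui1 :* v)) :* vj) :* ze
             := Ki :* ((ui1 :* (v :* vj)) :* ze) :+ Kj :* ((ui :* vj) :* (z :* ze)) :+ Ke :* ((ui :* (v :* vj)) :* ze1))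
             refl ui vj ze ui1 ze1 v z Ki Kj Ke ⟩
      Ki * ((ui1 * (v * vj)) * ze) + Kj * ((ui * vj) * (z * ze)) + Ke * ((ui * (v * vj)) * ze1)
        ≈⟨ +-cong (+-cong (·-as-* i _) (·-as-* j _)) (·-as-* e _) ⟨
      Γ.δu-term n i j + Γ.δv-term n i j + Γ.δz-term n i j ∎
      where
      e = Γ.zExp n i j
      ui = u ^ i ; vj = v ^ j ; ze = z ^ e ; ui1 = u ^ (i ∸ 1) ; ze1 = z ^ (e ∸ 1)
      Ki = i · 1# ; Kj = j · 1# ; Ke = e · 1#
      dU : proj₂ (Uᴰ Dᴿ.^ i) ≈ Ki * (ui1 * v)
      dU = trans (snd-^ u (proj₂ Uᴰ) i) (trans (×-congʳ i (*-congˡ snd-Uᴰ)) (·-as-* i _))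
      dV : proj₂ (Vᴰ Dᴿ.^ j) ≈ Kj * (vj * z)
      dV = trans (snd-^ v (proj₂ Vᴰ) j) (trans (·-pow-pred j v (proj₂ Vᴰ) z snd-Vᴰ) (·-as-* j _))
      dZ : proj₂ (Zᴰ Dᴿ.^ e) ≈ Ke * (ze1 * v)
      dZ = trans (snd-^ z (proj₂ Zᴰ) e) (trans (×-congʳ e (*-congˡ snd-Uᴰ)) (·-as-* e _))

    snd-Γ : ∀ n → proj₂ (Γᴰ.Γ n) ≈ Γ.δΓ n
    snd-Γ n = trans (reflexive (snd-sumList _ (upTo (suc n))))
      (sumBelow-cong (suc n) (λ i → trans (reflexive (snd-sumList _ (upTo (suc n))))
        (sumBelow-cong (suc n) (λ j → trans (reflexive (snd-· (γℕ n i j) (Γᴰ.term n i j)))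
                                            (×-congʳ (γℕ n i j) (snd-term n i j))))))

  generating-function : ∀ {c ℓ : Level} n (R : CommutativeRing c ℓ) (x y s t : CommutativeRing.Carrier R) →
                        CommutativeRing._≈_ R (Weights.L R x y s t n) (Weights.Γ R x y s t n)
  generating-function zero R x y s t =
    solve 0 (con 1 :* con 1 :* con 1 :* con 1 :+ con 0 := con 1 :* con 1 :* con 1 :+ con 0 :+ con 0 :+ con 0) refl
    where
    open CommutativeRing R
    open import Algebra.Solver.Ring.NaturalCoefficients.Default commutativeSemiring
  generating-function (suc n) R x y s t = begin
    sumList weight (𝔖 (suc (suc n)))
      ≈⟨ sumList-↭ weight (𝔖-suc-↭ (suc n)) ⟩
    sumList weight (concatMap (insertions (suc (suc n))) (𝔖 (suc n)))
      ≈⟨ sumList-concatMap weight (insertions (suc (suc n))) (𝔖 (suc n)) ⟩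
    sumList (sumList weight ∘ insertions (suc (suc n))) (𝔖 (suc n))
      ≈⟨ sumList-cong (𝔖 (suc n)) sum-insertions ⟩
    sumList (λ π → (s + t) * weight π + δmono (stats π)) (𝔖 (suc n))
      ≈⟨ trans (sumList-+ _ (δmono ∘ stats) (𝔖 (suc n))) (+-congʳ (sumList-*ˡ (s + t) weight (𝔖 (suc n)))) ⟩
    (s + t) * sumList weight (𝔖 (suc n)) + sumList (δmono ∘ stats) (𝔖 (suc n))
      ≈⟨ +-cong (*-congˡ (generating-function n R x y s t)) δ-part ⟩
    u * Γ n + δΓ n
      ≈⟨ Γ-suc n ⟨
    Γ (suc n) ∎
    where
    open CommutativeRing R
    open InRing R
    open Sums R
    open Weights R x y s t hiding (Γ)
    open Derivative R x y s t
    open GammaPolynomial R u v z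
    open import Relation.Binary.Reasoning.Setoid setoid
    δ-part : sumList (δmono ∘ stats) (𝔖 (suc n)) ≈ δΓ n
    δ-part = trans (sym (snd-weights (𝔖 (suc n))))
                   (trans (proj₂ (generating-function n (Dual R) Xᴰ Yᴰ Sᴰ Tᴰ)) (snd-Γ n))

open GeneratingFunction using (generating-function)

corollary3p14 : {c ℓ : Level} (R : CommutativeRing c ℓ) (n : ℕ)
                (x y s : CommutativeRing.Carrier R) →
                CommutativeRing._≈_ R (InRing.LHS R n x y s) (InRing.RHS R n x y)
corollary3p14 R n x y s = begin
  LHS n x y s   ≈⟨ generating-function n R x y s (- s) ⟩
  Γ n           ≈⟨ Γ-u≈0 (-‿inverseʳ s) n ⟩
  RHS n x y     ∎
  where
  open CommutativeRing R
  open InRing R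
  open GammaPolynomial R (s - s) ((2 · 1#) * x * y) (x + y)
  open import Relation.Binary.Reasoning.Setoid setoid
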